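{- Let $r\ge1$ be an integer and $x$ a nonzero rational number. For every integer $n\ge0$, \[ D_{r,\mathcal{A}}(n;x)=\sum_{j=0}^{r-1}b_{r,j}(n;x)\,D_{r,\mathcal{A}}(j;x)+g_r(n;x)\quad\text{in }\mathcal{A}, \] where, for $0\le j\le r-1$, the $b_{r,j}(n;x)\in\mathbb{Q}$ are defined by $b_{r,j}(n;x)=\delta_{j,n}$ for $0\le n\le r-1$ and $b_{r,j}(n+r;x)=x\sum_{k=0}^{n}\binom{n}{k}b_{r,j}(k;x)$ for $n\ge0$, and $(g_r(n;x))_{n\ge0}$ is defined by $g_r(n;x)=(-1)^{r-1}x\,\delta_{n,r}$ for $0\le n\le r$ and $g_r(n+r;x)=x\sum_{k=0}^{n}\binom{n}{k}g_r(k;x)$ for $n\ge1$.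
   Context: $\mathcal{A}\coloneqq\big(\prod_{p\text{ prime}}\mathbb{Z}/p\mathbb{Z}\big)/\big(\bigoplus_{p\text{ prime}}\mathbb{Z}/p\mathbb{Z}\big)$, a $\mathbb{Q}$-algebra via the diagonal embedding of $\mathbb{Q}$ (for the finitely many primes dividing a denominator, the $p$-component is assigned arbitrarily). For integers $r\ge1,n\ge0,N\ge1$, $D_r^{(N)}(n;x)\coloneqq\sum_{k=0}^{N-1}\frac{k^nx^k}{(k!)^r}$ (with $0^0=1$), and $D_{r,\mathcal{A}}(n;x)\coloneqq(D_r^{(p)}(n;x)\bmod p)_p\in\mathcal{A}$. $\delta$ is the Kronecker delta. -}

module Defs where

open import Data.Nat as ℕ using (ℕ; zero; suc; _∸_; _<ᵇ_; _%_; _!)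
open import Data.Nat.Properties using (m^n≢0; _!≢0)
open import Data.Nat.Combinatorics using (_C_)
open import Data.Integer as ℤ using (ℤ; +_)
open import Data.Integer.DivMod using (_%ℕ_)
open import Data.Rational as ℚ using (ℚ; 0ℚ; 1ℚ; _+_; _*_; -_; _/_)
open import Data.Bool using (if_then_else_)
open import Data.Nat.Primality using (Prime)
open import Data.Product using (∃)
open import Relation.Binary.PropositionalEquality using (_≡_)

ℕ→ℚ : ℕ → ℚ
ℕ→ℚ n = (+ n) / 1

_^ℚ_ : ℚ → ℕ → ℚ
x ^ℚ zero  = 1ℚ
x ^ℚ suc n = x * (x ^ℚ n)

sumℚ : ℕ → (ℕ → ℚ) → ℚ
sumℚ zero    f = 0ℚ
sumℚ (suc N) f = sumℚ N f + f N

δ : ℕ → ℕ → ℚ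
δ i j = if (i ℕ.≡ᵇ j) then 1ℚ else 0ℚ

inv-fact-pow : ℕ → ℕ → ℚ
inv-fact-pow k r = (+ 1) / ((k !) ℕ.^ r) where
  instance _ = m^n≢0 (k !) r {{k !≢0}}

-- D_r^{(N)}(n;x) = Σ_{k=0}^{N-1} k^n x^k / (k!)^r   (0^0 = 1)
D : (r n : ℕ) → ℚ → (N : ℕ) → ℚ
D r n x N = sumℚ N (λ k → ℕ→ℚ (k ℕ.^ n) * (x ^ℚ k) * inv-fact-pow k r)

-- Generic recursively defined sequence:
--   s(n) = init n                                  for n < L
--   s(n) = x * Σ_{k=0}^{n-r} C(n-r,k) s(k)        for n ≥ L
-- computed with fuel (fuel n+1 suffices whenever r ≥ 1 and L ≥ 1).
recSeqFuel : (L r : ℕ) → (init : ℕ → ℚ) → ℚ → ℕ → ℕ → ℚ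
recSeqFuel L r init x zero     n = 0ℚ
recSeqFuel L r init x (suc f)  n =
  if n <ᵇ L then init n
  else x * sumℚ (suc (n ∸ r)) (λ k → ℕ→ℚ ((n ∸ r) C k) * recSeqFuel L r init x f k)

recSeq : (L r : ℕ) → (init : ℕ → ℚ) → ℚ → ℕ → ℚ
recSeq L r init x n = recSeqFuel L r init x (suc n) n

b : (r j : ℕ) → ℚ → ℕ → ℚ
b r j x = recSeq r r (λ n → δ j n) x

g : (r : ℕ) → ℚ → ℕ → ℚ
g r x = recSeq (suc r) r (λ n → ((- 1ℚ) ^ℚ (r ∸ 1)) * x * δ n r) x

-- The ring 𝒜 = (Π_p Z/pZ) / (⊕_p Z/pZ).
-- An element is represented by a family of residues a p ∈ {0..p-1}
-- (only prime p matter); equality in 𝒜 is "equal for all but finitely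
-- many primes" (a setoid, since quotient types are unavailable).

𝒜 : Set
𝒜 = ℕ → ℕ

modP : ℕ → ℕ → ℕ
modP zero    a = a
modP (suc m) a = a % suc m

-- reduction of a rational n/d modulo p: n * d^(p-2) mod p
-- (= n * d⁻¹ mod p by Fermat when p ∤ d; arbitrary otherwise)
redℚ : ℕ → ℚ → ℕ
redℚ zero    q = 0
redℚ (suc m) q = ((ℚ.numerator q %ℕ suc m) ℕ.* (ℚ.denominatorℕ q ℕ.^ (m ∸ 1))) % suc m

ι : ℚ → 𝒜
ι q p = redℚ p q

_+𝒜_ : 𝒜 → 𝒜 → 𝒜
(a +𝒜 c) p = modP p (a p ℕ.+ c p)

_·𝒜_ : ℚ → 𝒜 → 𝒜
(q ·𝒜 a) p = modP p (redℚ p q ℕ.* a p)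

0𝒜 : 𝒜
0𝒜 p = 0

sum𝒜 : ℕ → (ℕ → 𝒜) → 𝒜
sum𝒜 zero    f = 0𝒜
sum𝒜 (suc N) f = sum𝒜 N f +𝒜 f N

infix 4 _≈𝒜_
_≈𝒜_ : 𝒜 → 𝒜 → Set
a ≈𝒜 c = ∃ λ M → ∀ p → Prime p → M ℕ.< p → modP p (a p) ≡ modP p (c p)

D𝒜 : (r n : ℕ) → ℚ → 𝒜
D𝒜 r n x p = redℚ p (D r n x p)

-- Fix a prime p exceeding |numerator| + denominator of x and compute with p-integral
-- rationals modulo p. Shifting the summation index k ↦ k + 1 in D_r^{(p)}(n + r; x) turns
-- the summand k^(n+r) x^k / (k!)^r into x (k+1)^n x^k / (k!)^r, so by the binomial theorem
-- D_r^{(p)}(n + r; x) = x Σ_k C(n,k) D_r^{(p)}(k; x) − x T_n with the single boundary term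
-- T_n = p^n x^(p−1) / ((p−1)!)^r. By Fermat and Wilson, T_0 ≡ (−1)^r and T_n ≡ 0 for n ≥ 1,
-- so modulo p the sequence D_r^{(p)}(·; x) obeys the recurrences defining b and g, and
-- induction on n gives the identity modulo every such p, i.e. in 𝒜. Wilson's theorem comes
-- from evaluating Σ_k (−1)^k C(p−1,k) k^(p−1) twice: exactly, as the finite difference
-- (−1)^(p−1) (p−1)!, and modulo p, as Σ_{k≥1} (−1)^k C(p−1,k) = −1 by Fermat.

module Submission where

open import Defs
open import Data.Bool using (true; false; T)
open import Data.Empty using (⊥-elim)
open import Data.Integer as ℤ using (ℤ; -[1+_])
open import Data.Integer.DivMod using (_%ℕ_; _/ℕ_; a≡a%ℕn+[a/ℕn]*n)
import Data.Integer.Properties as ℤP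
open import Data.Nat as ℕ using (ℕ; zero; suc; _≤_; _<_; z≤n; s≤s; NonZero; _!; _%_; _∸_; _<ᵇ_)
open import Data.Nat.Combinatorics using (_C_; nCk+nC[k+1]≡[n+1]C[k+1]; nCn≡1; nC1≡n; nCk≡nC[n∸k])
open import Data.Nat.Combinatorics.Specification using (k>n⇒nCk≡0)
open import Data.Nat.Coprimality using (Coprime; coprime?; coprime-divisor) renaming (sym to coprime-sym)
open import Data.Nat.Divisibility using (_∣_; _∤_; ∣-trans; ∣1⇒≡1; >⇒∤; divides)
open import Data.Nat.DivMod using (%-remove-+ʳ)
open import Data.Nat.Induction using (<-rec)
open import Data.Nat.Primality using (Prime; euclidsLemma)
import Data.Nat.Properties as ℕP
open import Data.Nat.Properties using (m^n≢0; _!≢0)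
import Data.Nat.Solver as ℕSolver
open import Data.Product using (_,_)
open import Data.Rational as ℚ using (ℚ; 0ℚ; 1ℚ; _+_; _*_; -_; _-_; _/_)
import Data.Rational.Properties as ℚP
import Data.Rational.Solver as ℚSolver
open import Data.Rational.Unnormalised using (mkℚᵘ; *≡*) renaming (_≃_ to _≃ᵘ_)
import Data.Rational.Unnormalised.Properties as ℚᵘP
open import Data.Sum using ([_,_]; inj₁; inj₂)
open import Data.Unit using (tt)
open import Function using (_$_; _∘_; _∋_; id)
open import Relation.Binary.Bundles using (Setoid)
open import Relation.Binary.PropositionalEquality hiding ([_])
import Relation.Binary.Reasoning.Setoid as SetoidReasoning
open import Relation.Nullary using (yes; no; Dec)
open import Relation.Nullary.Decidable using (recompute)

ℤ→ℚ : ℤ → ℚ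
ℤ→ℚ i = i / 1

toℚᵘ-/ : ∀ i d-1 → ℚ.toℚᵘ (i / suc d-1) ≃ᵘ mkℚᵘ i d-1
toℚᵘ-/ i d-1 = ℚP.toℚᵘ-fromℚᵘ (mkℚᵘ i d-1)

≃ᵘ-ℤ→ℚ⇒≡ : ∀ {q} i → ℚ.toℚᵘ q ≃ᵘ mkℚᵘ i 0 → q ≡ ℤ→ℚ i
≃ᵘ-ℤ→ℚ⇒≡ i q≃i = ℚP.toℚᵘ-injective (ℚᵘP.≃-trans q≃i (ℚᵘP.≃-sym (toℚᵘ-/ i 0)))

ℤ→ℚ-homo-+ : ∀ i j → ℤ→ℚ (i ℤ.+ j) ≡ ℤ→ℚ i + ℤ→ℚ j
ℤ→ℚ-homo-+ i j = sym $ ≃ᵘ-ℤ→ℚ⇒≡ (i ℤ.+ j) $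
  ℚᵘP.≃-trans (ℚP.toℚᵘ-homo-+ (ℤ→ℚ i) (ℤ→ℚ j)) $
  ℚᵘP.≃-trans (ℚᵘP.+-cong (toℚᵘ-/ i 0) (toℚᵘ-/ j 0)) $
  *≡* (cong (ℤ._* ℤ.+ 1) (cong₂ ℤ._+_ (ℤP.*-identityʳ i) (ℤP.*-identityʳ j)))

ℤ→ℚ-homo-* : ∀ i j → ℤ→ℚ (i ℤ.* j) ≡ ℤ→ℚ i * ℤ→ℚ j
ℤ→ℚ-homo-* i j = sym $ ≃ᵘ-ℤ→ℚ⇒≡ (i ℤ.* j) $
  ℚᵘP.≃-trans (ℚP.toℚᵘ-homo-* (ℤ→ℚ i) (ℤ→ℚ j)) $
  ℚᵘP.≃-trans (ℚᵘP.*-cong (toℚᵘ-/ i 0) (toℚᵘ-/ j 0)) (*≡* refl)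

ℤ→ℚ-homo‿- : ∀ i → ℤ→ℚ (ℤ.- i) ≡ - ℤ→ℚ i
ℤ→ℚ-homo‿- i = sym $ ≃ᵘ-ℤ→ℚ⇒≡ (ℤ.- i) $
  ℚᵘP.≃-trans (ℚP.toℚᵘ-homo‿- (ℤ→ℚ i)) (ℚᵘP.-‿cong (toℚᵘ-/ i 0))

ℤ→ℚ-injective : ∀ {i j} → ℤ→ℚ i ≡ ℤ→ℚ j → i ≡ j
ℤ→ℚ-injective {i} {j} eq
  with ℚᵘP.≃-trans (ℚᵘP.≃-sym (toℚᵘ-/ i 0)) (ℚᵘP.≃-trans (ℚP.toℚᵘ-cong eq) (toℚᵘ-/ j 0))
... | *≡* i*1≡j*1 = trans (sym (ℤP.*-identityʳ i)) (trans i*1≡j*1 (ℤP.*-identityʳ j))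

/-*-cancel : ∀ i d-1 → (i / suc d-1) * ℕ→ℚ (suc d-1) ≡ ℤ→ℚ i
/-*-cancel i d-1 = ≃ᵘ-ℤ→ℚ⇒≡ i $
  ℚᵘP.≃-trans (ℚP.toℚᵘ-homo-* (i / suc d-1) (ℕ→ℚ (suc d-1))) $
  ℚᵘP.≃-trans (ℚᵘP.*-cong (toℚᵘ-/ i d-1) (toℚᵘ-/ (ℤ.+ suc d-1) 0)) $
  *≡* (trans (ℤP.*-identityʳ _) (cong (i ℤ.*_) (cong ℤ.+_ (sym (ℕP.*-identityʳ (suc d-1))))))

1/n*n≡1 : ∀ n .{{_ : NonZero n}} → ((ℤ.+ 1) / n) * ℕ→ℚ n ≡ 1ℚ
1/n*n≡1 (suc n-1) = /-*-cancel (ℤ.+ 1) n-1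

*-↧≡↥ : ∀ y → y * ℕ→ℚ (ℚ.denominatorℕ y) ≡ ℤ→ℚ (ℚ.numerator y)
*-↧≡↥ y = trans (cong (_* ℕ→ℚ (ℚ.denominatorℕ y)) (sym (ℚP.↥p/↧p≡p y)))
                (/-*-cancel (ℚ.numerator y) (ℚ.denominator-1 y))

↥-↧-coprime : ∀ y → Coprime ℤ.∣ ℚ.numerator y ∣ (ℚ.denominatorℕ y)
↥-↧-coprime (ℚ.mkℚ n d-1 c) = recompute (coprime? ℤ.∣ n ∣ (suc d-1)) c

ℕ→ℚ-homo-+ : ∀ m n → ℕ→ℚ (m ℕ.+ n) ≡ ℕ→ℚ m + ℕ→ℚ n
ℕ→ℚ-homo-+ m n = trans (cong ℤ→ℚ (ℤP.pos-+ m n)) (ℤ→ℚ-homo-+ (ℤ.+ m) (ℤ.+ n))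

ℕ→ℚ-homo-* : ∀ m n → ℕ→ℚ (m ℕ.* n) ≡ ℕ→ℚ m * ℕ→ℚ n
ℕ→ℚ-homo-* m n = trans (cong ℤ→ℚ (ℤP.pos-* m n)) (ℤ→ℚ-homo-* (ℤ.+ m) (ℤ.+ n))

ℕ→ℚ-homo-^ : ∀ m n → ℕ→ℚ (m ℕ.^ n) ≡ ℕ→ℚ m ^ℚ n
ℕ→ℚ-homo-^ m zero    = refl
ℕ→ℚ-homo-^ m (suc n) = trans (ℕ→ℚ-homo-* m (m ℕ.^ n)) (cong (ℕ→ℚ m *_) (ℕ→ℚ-homo-^ m n))

ℕ→ℚ-suc : ∀ n → ℕ→ℚ (suc n) ≡ ℕ→ℚ n + 1ℚ
ℕ→ℚ-suc n = trans (cong ℕ→ℚ (ℕP.+-comm 1 n)) (ℕ→ℚ-homo-+ n 1)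

^ℚ-distrib-* : ∀ a b n → (a * b) ^ℚ n ≡ a ^ℚ n * b ^ℚ n
^ℚ-distrib-* a b zero    = refl
^ℚ-distrib-* a b (suc n) = trans (cong (a * b *_) (^ℚ-distrib-* a b n))
  (solve 4 (λ a b x y → a :* b :* (x :* y) := a :* x :* (b :* y)) refl a b (a ^ℚ n) (b ^ℚ n))
  where open ℚSolver.+-*-Solver

clear-+ : ∀ x y d d' → (x + y) * ℤ→ℚ (d ℤ.* d') ≡ x * ℤ→ℚ d * ℤ→ℚ d' + y * ℤ→ℚ d' * ℤ→ℚ d
clear-+ x y d d' = trans (cong ((x + y) *_) (ℤ→ℚ-homo-* d d'))
  (solve 4 (λ x y D D' → (x :+ y) :* (D :* D') := x :* D :* D' :+ y :* D' :* D) refl x y (ℤ→ℚ d) (ℤ→ℚ d'))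
  where open ℚSolver.+-*-Solver

clear-* : ∀ x y d d' → (x * y) * ℤ→ℚ (d ℤ.* d') ≡ (x * ℤ→ℚ d) * (y * ℤ→ℚ d')
clear-* x y d d' = trans (cong ((x * y) *_) (ℤ→ℚ-homo-* d d'))
  (solve 4 (λ x y D D' → (x :* y) :* (D :* D') := (x :* D) :* (y :* D')) refl x y (ℤ→ℚ d) (ℤ→ℚ d'))
  where open ℚSolver.+-*-Solver

∣∣m⊖n∣⇒%≡ : ∀ {d} .{{_ : NonZero d}} m n → d ∣ ℤ.∣ m ℤ.⊖ n ∣ → m % d ≡ n % d
∣∣m⊖n∣⇒%≡ {d} m n d∣m⊖n with ℕP.≤-total m n
... | inj₁ m≤n = sym $ trans (cong (_% d) (sym (ℕP.m+[n∸m]≡n m≤n)))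
                             (%-remove-+ʳ m (subst (d ∣_) (ℤP.∣⊖∣-≤ m≤n) d∣m⊖n))
... | inj₂ n≤m = trans (cong (_% d) (sym (ℕP.m+[n∸m]≡n n≤m)))
                       (%-remove-+ʳ n (subst (d ∣_) (trans (ℤP.∣m⊖n∣≡∣n⊖m∣ m n) (ℤP.∣⊖∣-≤ n≤m)) d∣m⊖n))

-- Finite sums and binomial coefficients

sumℚ-cong : ∀ N {f g : ℕ → ℚ} → (∀ k → k < N → f k ≡ g k) → sumℚ N f ≡ sumℚ N g
sumℚ-cong zero    f≡g = refl
sumℚ-cong (suc N) f≡g =
  cong₂ _+_ (sumℚ-cong N (λ k k<N → f≡g k (ℕP.m<n⇒m<1+n k<N))) (f≡g N ℕP.≤-refl)

sumℚ-zero : ∀ N {f : ℕ → ℚ} → (∀ k → k < N → f k ≡ 0ℚ) → sumℚ N f ≡ 0ℚ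
sumℚ-zero zero    f≡0 = refl
sumℚ-zero (suc N) f≡0 =
  trans (cong₂ _+_ (sumℚ-zero N (λ k k<N → f≡0 k (ℕP.m<n⇒m<1+n k<N))) (f≡0 N ℕP.≤-refl))
        (ℚP.+-identityʳ 0ℚ)

sumℚ-+ : ∀ N (f g : ℕ → ℚ) → sumℚ N (λ k → f k + g k) ≡ sumℚ N f + sumℚ N g
sumℚ-+ zero    f g = refl
sumℚ-+ (suc N) f g = trans (cong (_+ (f N + g N)) (sumℚ-+ N f g))
  (solve 4 (λ a b c d → (a :+ b) :+ (c :+ d) := (a :+ c) :+ (b :+ d)) refl
           (sumℚ N f) (sumℚ N g) (f N) (g N))
  where open ℚSolver.+-*-Solver

sumℚ-*ˡ : ∀ N c (f : ℕ → ℚ) → sumℚ N (λ k → c * f k) ≡ c * sumℚ N f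
sumℚ-*ˡ zero    c f = sym (ℚP.*-zeroʳ c)
sumℚ-*ˡ (suc N) c f = trans (cong (_+ c * f N) (sumℚ-*ˡ N c f))
                            (sym (ℚP.*-distribˡ-+ c (sumℚ N f) (f N)))

sumℚ-neg : ∀ N (f : ℕ → ℚ) → sumℚ N (λ k → - f k) ≡ - sumℚ N f
sumℚ-neg zero    f = refl
sumℚ-neg (suc N) f = trans (cong (_+ - f N) (sumℚ-neg N f))
                           (sym (ℚP.neg-distrib-+ (sumℚ N f) (f N)))

sumℚ-head : ∀ N (f : ℕ → ℚ) → sumℚ (suc N) f ≡ f 0 + sumℚ N (f ∘ suc)
sumℚ-head zero    f = ℚP.+-comm 0ℚ (f 0)
sumℚ-head (suc N) f = trans (cong (_+ f (suc N)) (sumℚ-head N f))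
                            (ℚP.+-assoc (f 0) (sumℚ N (f ∘ suc)) (f (suc N)))

sumℚ-swap : ∀ N M (f : ℕ → ℕ → ℚ) →
            sumℚ N (λ i → sumℚ M (f i)) ≡ sumℚ M (λ j → sumℚ N (λ i → f i j))
sumℚ-swap zero    M f = sym (sumℚ-zero M (λ _ _ → refl))
sumℚ-swap (suc N) M f = trans (cong (_+ sumℚ M (f N)) (sumℚ-swap N M f))
                              (sym (sumℚ-+ M (λ j → sumℚ N (λ i → f i j)) (f N)))

sumℚ-regroup : ∀ M R x (c : ℕ → ℚ) (β : ℕ → ℕ → ℚ) (e γ : ℕ → ℚ) →
  x * sumℚ M (λ k → c k * (sumℚ R (λ j → β j k * e j) + γ k)) ≡
  sumℚ R (λ j → (x * sumℚ M (λ k → c k * β j k)) * e j) + x * sumℚ M (λ k → c k * γ k)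
sumℚ-regroup M R x c β e γ = begin
  x * sumℚ M (λ k → c k * (sumℚ R (λ j → β j k * e j) + γ k))
    ≡⟨ cong (x *_) (trans (sumℚ-cong M (λ k _ → distribute k)) (sumℚ-+ M _ _)) ⟩
  x * (sumℚ M (λ k → sumℚ R (λ j → c k * (β j k * e j))) + Γ)
    ≡⟨ cong (λ v → x * (v + Γ)) (trans (sumℚ-swap M R _) (sumℚ-cong R (λ j _ → factor j))) ⟩
  x * (sumℚ R (λ j → sumℚ M (λ k → c k * β j k) * e j) + Γ)
    ≡⟨ ℚP.*-distribˡ-+ x _ Γ ⟩
  x * sumℚ R (λ j → sumℚ M (λ k → c k * β j k) * e j) + x * Γ
    ≡⟨ cong (_+ x * Γ) (trans (sym (sumℚ-*ˡ R x _)) (sumℚ-cong R (λ j _ → sym (ℚP.*-assoc x _ (e j))))) ⟩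
  sumℚ R (λ j → (x * sumℚ M (λ k → c k * β j k)) * e j) + x * Γ ∎
  where
  open ≡-Reasoning
  open ℚSolver.+-*-Solver
  Γ = sumℚ M (λ k → c k * γ k)
  distribute : ∀ k → c k * (sumℚ R (λ j → β j k * e j) + γ k) ≡
                     sumℚ R (λ j → c k * (β j k * e j)) + c k * γ k
  distribute k = trans (ℚP.*-distribˡ-+ (c k) _ (γ k))
                       (cong (_+ c k * γ k) (sym (sumℚ-*ˡ R (c k) (λ j → β j k * e j))))
  factor : ∀ j → sumℚ M (λ k → c k * (β j k * e j)) ≡ sumℚ M (λ k → c k * β j k) * e j
  factor j = trans (sumℚ-cong M λ k _ → solve 3 (λ c b e → c :* (b :* e) := e :* (c :* b)) refl
                                                (c k) (β j k) (e j))
                   (trans (sumℚ-*ˡ M (e j) (λ k → c k * β j k)) (ℚP.*-comm (e j) _))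

δ-refl : ∀ n → δ n n ≡ 1ℚ
δ-refl zero    = refl
δ-refl (suc n) = δ-refl n

δ-≢ : ∀ {i j} → i ≢ j → δ i j ≡ 0ℚ
δ-≢ {zero}  {zero}  i≢j = ⊥-elim (i≢j refl)
δ-≢ {zero}  {suc j} i≢j = refl
δ-≢ {suc i} {zero}  i≢j = refl
δ-≢ {suc i} {suc j} i≢j = δ-≢ (i≢j ∘ cong suc)

sumℚ-δ : ∀ N {n} (h : ℕ → ℚ) → n < N → sumℚ N (λ j → δ j n * h j) ≡ h n
sumℚ-δ (suc N) {n} h (s≤s n≤N) with n ℕP.≟ N
... | yes refl = trans (cong₂ _+_ (sumℚ-zero N (λ j j<N → δ≢-* (ℕP.<⇒≢ j<N)))
                                  (cong (_* h N) (δ-refl N)))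
                       (trans (ℚP.+-identityˡ (1ℚ * h N)) (ℚP.*-identityˡ (h N)))
  where δ≢-* : ∀ {j} → j ≢ N → δ j N * h j ≡ 0ℚ
        δ≢-* {j} j≢N = trans (cong (_* h j) (δ-≢ j≢N)) (ℚP.*-zeroˡ (h j))
... | no n≢N = trans (cong₂ _+_ (sumℚ-δ N h (ℕP.≤∧≢⇒< n≤N n≢N))
                                (trans (cong (_* h N) (δ-≢ (n≢N ∘ sym))) (ℚP.*-zeroˡ (h N))))
                     (ℚP.+-identityʳ (h n))

ℕ→ℚ-pascal : ∀ n k → ℕ→ℚ (suc n C suc k) ≡ ℕ→ℚ (n C k) + ℕ→ℚ (n C suc k)
ℕ→ℚ-pascal n k = trans (cong ℕ→ℚ (sym (nCk+nC[k+1]≡[n+1]C[k+1] n k)))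
                       (ℕ→ℚ-homo-+ (n C k) (n C suc k))

pascal-sum : ∀ n N (f : ℕ → ℚ) →
             sumℚ (suc N) (λ k → ℕ→ℚ (suc n C k) * f k) ≡
             sumℚ (suc N) (λ k → ℕ→ℚ (n C k) * f k) + sumℚ N (λ k → ℕ→ℚ (n C k) * f (suc k))
pascal-sum n N f = begin
  sumℚ (suc N) (λ k → ℕ→ℚ (suc n C k) * f k)
    ≡⟨ sumℚ-head N _ ⟩
  f₀ + sumℚ N (λ k → ℕ→ℚ (suc n C suc k) * f (suc k))
    ≡⟨ cong (f₀ +_) (trans (sumℚ-cong N λ k _ → split k) (sumℚ-+ N _ _)) ⟩
  f₀ + (S + S')
    ≡⟨ solve 3 (λ a s t → a :+ (s :+ t) := (a :+ t) :+ s) refl f₀ S S' ⟩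
  (f₀ + S') + S
    ≡⟨ cong (_+ S) (sumℚ-head N _) ⟨
  sumℚ (suc N) (λ k → ℕ→ℚ (n C k) * f k) + S ∎
  where
  open ≡-Reasoning
  open ℚSolver.+-*-Solver
  f₀ = 1ℚ * f 0
  S  = sumℚ N (λ k → ℕ→ℚ (n C k) * f (suc k))
  S' = sumℚ N (λ k → ℕ→ℚ (n C suc k) * f (suc k))
  split : ∀ k → ℕ→ℚ (suc n C suc k) * f (suc k) ≡
                ℕ→ℚ (n C k) * f (suc k) + ℕ→ℚ (n C suc k) * f (suc k)
  split k = trans (cong (_* f (suc k)) (ℕ→ℚ-pascal n k))
                  (ℚP.*-distribʳ-+ (f (suc k)) (ℕ→ℚ (n C k)) (ℕ→ℚ (n C suc k)))

binomial : ∀ a n → (a + 1ℚ) ^ℚ n ≡ sumℚ (suc n) (λ k → ℕ→ℚ (n C k) * a ^ℚ k)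
binomial a n = sym (partial n (suc n) ℕP.≤-refl)
  where
  B : ℕ → ℕ → ℚ
  B n N = sumℚ N (λ k → ℕ→ℚ (n C k) * a ^ℚ k)

  partial : ∀ n N → n < N → B n N ≡ (a + 1ℚ) ^ℚ n
  partial zero    (suc N) _         = trans (sumℚ-head N _)
    (cong (1ℚ * 1ℚ +_) (sumℚ-zero N (λ k _ → ℚP.*-zeroˡ (a ^ℚ suc k))))
  partial (suc n) (suc N) (s≤s n<N) = begin
    B (suc n) (suc N)
      ≡⟨ pascal-sum n N (a ^ℚ_) ⟩
    B n (suc N) + sumℚ N (λ k → ℕ→ℚ (n C k) * (a * a ^ℚ k))
      ≡⟨ cong (B n (suc N) +_) (trans (sumℚ-cong N λ k _ → *-commute (ℕ→ℚ (n C k)) (a ^ℚ k))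
                                      (sumℚ-*ˡ N a _)) ⟩
    B n (suc N) + a * B n N
      ≡⟨ cong₂ (λ u v → u + a * v) (partial n (suc N) (ℕP.m<n⇒m<1+n n<N)) (partial n N n<N) ⟩
    (a + 1ℚ) ^ℚ n + a * (a + 1ℚ) ^ℚ n
      ≡⟨ solve 2 (λ a u → u :+ a :* u := (a :+ con 1ℚ) :* u) refl a ((a + 1ℚ) ^ℚ n) ⟩
    (a + 1ℚ) ^ℚ suc n ∎
    where
    open ≡-Reasoning
    open ℚSolver.+-*-Solver
    *-commute : ∀ c b → c * (a * b) ≡ a * (c * b)
    *-commute c b = solve 3 (λ c a b → c :* (a :* b) := a :* (c :* b)) refl c a b

[k+1]*[n+1]C[k+1]≡[n+1]*nCk : ∀ n k → suc k ℕ.* (suc n C suc k) ≡ suc n ℕ.* (n C k)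
[k+1]*[n+1]C[k+1]≡[n+1]*nCk zero    zero    = refl
[k+1]*[n+1]C[k+1]≡[n+1]*nCk zero    (suc k) = ℕP.*-zeroʳ (suc (suc k))
[k+1]*[n+1]C[k+1]≡[n+1]*nCk (suc n) zero    =
  trans (ℕP.+-identityʳ _) (trans (nC1≡n (suc (suc n))) (sym (ℕP.*-identityʳ (suc (suc n)))))
[k+1]*[n+1]C[k+1]≡[n+1]*nCk (suc n) (suc k) = begin
  suc (suc k) ℕ.* (suc (suc n) C suc (suc k))
    ≡⟨ cong (suc (suc k) ℕ.*_) (nCk+nC[k+1]≡[n+1]C[k+1] (suc n) (suc k)) ⟨
  suc (suc k) ℕ.* (X ℕ.+ Y)
    ≡⟨ solve 3 (λ k x y → (con 2 :+ k) :* (x :+ y) := x :+ (con 1 :+ k) :* x :+ (con 2 :+ k) :* y)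
               refl k X Y ⟩
  X ℕ.+ suc k ℕ.* X ℕ.+ suc (suc k) ℕ.* Y
    ≡⟨ cong₂ (λ u v → X ℕ.+ u ℕ.+ v) ([k+1]*[n+1]C[k+1]≡[n+1]*nCk n k)
                                     ([k+1]*[n+1]C[k+1]≡[n+1]*nCk n (suc k)) ⟩
  X ℕ.+ suc n ℕ.* (n C k) ℕ.+ suc n ℕ.* (n C suc k)
    ≡⟨ solve 4 (λ x n u v → x :+ (con 1 :+ n) :* u :+ (con 1 :+ n) :* v := x :+ (con 1 :+ n) :* (u :+ v))
               refl X n (n C k) (n C suc k) ⟩
  X ℕ.+ suc n ℕ.* (n C k ℕ.+ n C suc k)
    ≡⟨ cong (λ w → X ℕ.+ suc n ℕ.* w) (nCk+nC[k+1]≡[n+1]C[k+1] n k) ⟩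
  X ℕ.+ suc n ℕ.* X
    ≡⟨ solve 2 (λ x n → x :+ (con 1 :+ n) :* x := (con 2 :+ n) :* x) refl X n ⟩
  suc (suc n) ℕ.* X ∎
  where
  open ≡-Reasoning
  open ℕSolver.+-*-Solver
  X = suc n C suc k
  Y = suc n C suc (suc k)

[-1]^_ : ℕ → ℚ
[-1]^ k = (- 1ℚ) ^ℚ k

[-1]^k*[-1]^k≡1 : ∀ k → [-1]^ k * [-1]^ k ≡ 1ℚ
[-1]^k*[-1]^k≡1 zero    = refl
[-1]^k*[-1]^k≡1 (suc k) = trans
  (solve 1 (λ s → con (- 1ℚ) :* s :* (con (- 1ℚ) :* s) := s :* s) refl ([-1]^ k))
  ([-1]^k*[-1]^k≡1 k)
  where open ℚSolver.+-*-Solver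

altBinomialSum : (ℕ → ℚ) → ℕ → ℕ → ℚ
altBinomialSum f n N = sumℚ N (λ k → ℕ→ℚ (n C k) * ([-1]^ k * f k))

altBinomialSum-suc : ∀ f n N →
  altBinomialSum f (suc n) (suc N) ≡ altBinomialSum f n (suc N) - altBinomialSum (f ∘ suc) n N
altBinomialSum-suc f n N = trans (pascal-sum n N (λ k → [-1]^ k * f k))
  (cong (altBinomialSum f n (suc N) +_)
    (trans (sumℚ-cong N (λ k _ → sign-flip (ℕ→ℚ (n C k)) ([-1]^ k) (f (suc k)))) (sumℚ-neg N _)))
  where
  open ℚSolver.+-*-Solver
  sign-flip : ∀ c s y → c * ((- 1ℚ * s) * y) ≡ - (c * (s * y))
  sign-flip = solve 3 (λ c s y → c :* ((con (- 1ℚ) :* s) :* y) := :- (c :* (s :* y))) refl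

altBinomialSum-linear : ∀ M (c : ℕ → ℚ) (f : ℕ → ℕ → ℚ) n N →
  altBinomialSum (λ k → sumℚ M (λ i → c i * f i k)) n N ≡
  sumℚ M (λ i → c i * altBinomialSum (f i) n N)
altBinomialSum-linear M c f n N = begin
  sumℚ N (λ k → w k * (s k * sumℚ M (λ i → c i * f i k)))
    ≡⟨ sumℚ-cong N (λ k _ → trans (sym (ℚP.*-assoc (w k) (s k) _)) (sym (sumℚ-*ˡ M (w k * s k) _))) ⟩
  sumℚ N (λ k → sumℚ M (λ i → w k * s k * (c i * f i k)))
    ≡⟨ sumℚ-swap N M _ ⟩
  sumℚ M (λ i → sumℚ N (λ k → w k * s k * (c i * f i k)))
    ≡⟨ sumℚ-cong M (λ i _ → trans (sumℚ-cong N (λ k _ → rearrange (w k) (s k) (c i) (f i k)))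
                                  (sumℚ-*ˡ N (c i) _)) ⟩
  sumℚ M (λ i → c i * altBinomialSum (f i) n N) ∎
  where
  open ≡-Reasoning
  open ℚSolver.+-*-Solver
  w = λ k → ℕ→ℚ (n C k)
  s = [-1]^_
  rearrange : ∀ a b c y → a * b * (c * y) ≡ c * (a * (b * y))
  rearrange = solve 4 (λ a b c y → a :* b :* (c :* y) := c :* (a :* (b :* y))) refl

altBinomialSum-suc-^ : ∀ m n N →
  altBinomialSum (λ k → ℕ→ℚ (suc k) ^ℚ m) n N ≡
  sumℚ (suc m) (λ i → ℕ→ℚ (m C i) * altBinomialSum (λ k → ℕ→ℚ k ^ℚ i) n N)
altBinomialSum-suc-^ m n N = trans
  (sumℚ-cong N (λ k _ → cong (λ v → ℕ→ℚ (n C k) * ([-1]^ k * v))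
                              (trans (cong (_^ℚ m) (ℕ→ℚ-suc k)) (binomial (ℕ→ℚ k) m))))
  (altBinomialSum-linear (suc m) (λ i → ℕ→ℚ (m C i)) (λ i k → ℕ→ℚ k ^ℚ i) n N)

-- (−1)^n times the n-th forward difference of k ↦ k^m at 0.
altPowerSum : ℕ → ℕ → ℚ
altPowerSum m n = altBinomialSum (λ k → ℕ→ℚ k ^ℚ m) n (suc n)

altPowerSum-suc : ∀ m n → altPowerSum m (suc n) ≡ - sumℚ m (λ i → ℕ→ℚ (m C i) * altPowerSum i n)
altPowerSum-suc m n = begin
  altPowerSum m (suc n)
    ≡⟨ altBinomialSum-suc (λ k → ℕ→ℚ k ^ℚ m) n (suc n) ⟩
  (A + ℕ→ℚ (n C suc n) * y) - altBinomialSum (λ k → ℕ→ℚ (suc k) ^ℚ m) n (suc n)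
    ≡⟨ cong₂ (λ c v → (A + ℕ→ℚ c * y) - v) (k>n⇒nCk≡0 (ℕP.n<1+n n)) (altBinomialSum-suc-^ m n (suc n)) ⟩
  (A + 0ℚ * y) - (S + ℕ→ℚ (m C m) * A)
    ≡⟨ cong (λ c → (A + 0ℚ * y) - (S + ℕ→ℚ c * A)) (nCn≡1 m) ⟩
  (A + 0ℚ * y) - (S + 1ℚ * A)
    ≡⟨ solve 3 (λ a s y → (a :+ con 0ℚ :* y) :- (s :+ con 1ℚ :* a) := :- s) refl A S y ⟩
  - S ∎
  where
  open ≡-Reasoning
  open ℚSolver.+-*-Solver
  A = altPowerSum m n
  S = sumℚ m (λ i → ℕ→ℚ (m C i) * altPowerSum i n)
  y = [-1]^ suc n * ℕ→ℚ (suc n) ^ℚ m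

altPowerSum-below : ∀ {m n} → m < n → altPowerSum m n ≡ 0ℚ
altPowerSum-below {m} {suc n} (s≤s m≤n) = trans (altPowerSum-suc m n) (cong -_ (sumℚ-zero m vanish))
  where
  vanish : ∀ i → i < m → ℕ→ℚ (m C i) * altPowerSum i n ≡ 0ℚ
  vanish i i<m = trans (cong (ℕ→ℚ (m C i) *_) (altPowerSum-below (ℕP.<-≤-trans i<m m≤n)))
                       (ℚP.*-zeroʳ (ℕ→ℚ (m C i)))

altPowerSum-diag : ∀ n → altPowerSum n n ≡ [-1]^ n * ℕ→ℚ (n !)
altPowerSum-diag zero    = refl
altPowerSum-diag (suc n) = begin
  altPowerSum (suc n) (suc n)
    ≡⟨ altPowerSum-suc (suc n) n ⟩
  - (sumℚ n (λ i → ℕ→ℚ (suc n C i) * altPowerSum i n) + ℕ→ℚ (suc n C n) * altPowerSum n n)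
    ≡⟨ cong₂ (λ u v → - (u + v)) (sumℚ-zero n vanish)
                                 (cong₂ _*_ (cong ℕ→ℚ [n+1]Cn≡n+1) (altPowerSum-diag n)) ⟩
  - (0ℚ + ℕ→ℚ (suc n) * ([-1]^ n * ℕ→ℚ (n !)))
    ≡⟨ solve 3 (λ a s f → :- (con 0ℚ :+ a :* (s :* f)) := con (- 1ℚ) :* s :* (a :* f)) refl
               (ℕ→ℚ (suc n)) ([-1]^ n) (ℕ→ℚ (n !)) ⟩
  [-1]^ suc n * (ℕ→ℚ (suc n) * ℕ→ℚ (n !))
    ≡⟨ cong ([-1]^ suc n *_) (ℕ→ℚ-homo-* (suc n) (n !)) ⟨
  [-1]^ suc n * ℕ→ℚ (suc n !) ∎
  where
  open ≡-Reasoning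
  open ℚSolver.+-*-Solver
  vanish : ∀ i → i < n → ℕ→ℚ (suc n C i) * altPowerSum i n ≡ 0ℚ
  vanish i i<n = trans (cong (ℕ→ℚ (suc n C i) *_) (altPowerSum-below i<n))
                       (ℚP.*-zeroʳ (ℕ→ℚ (suc n C i)))
  [n+1]Cn≡n+1 : suc n C n ≡ suc n
  [n+1]Cn≡n+1 = trans (nCk≡nC[n∸k] (ℕP.n≤1+n n))
                      (trans (cong (suc n C_) (ℕP.m+n∸n≡m 1 n)) (nC1≡n (suc n)))

module RecSeq (L-1 r-1 : ℕ) (init : ℕ → ℚ) (x : ℚ) where

  L r : ℕ
  L = suc L-1
  r = suc r-1

  fuelled : ℕ → ℕ → ℚ
  fuelled = recSeqFuel L r init x

  step : (ℕ → ℚ) → ℕ → ℚ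
  step s n = x * sumℚ (suc (n ∸ r)) (λ k → ℕ→ℚ ((n ∸ r) C k) * s k)

  fuelled-init : ∀ f {n} → n < L → fuelled (suc f) n ≡ init n
  fuelled-init f {n} n<L with n <ᵇ L | ℕP.<⇒<ᵇ n<L
  ... | true | _ = refl

  fuelled-step : ∀ f {n} → L ≤ n → fuelled (suc f) n ≡ step (fuelled f) n
  fuelled-step f {n} L≤n with n <ᵇ L in n<ᵇL
  ... | false = refl
  ... | true  = ⊥-elim (ℕP.<⇒≱ (ℕP.<ᵇ⇒< n L (subst T (sym n<ᵇL) tt)) L≤n)

  step-arg< : ∀ {n k} → L ≤ n → k < suc (n ∸ r) → k < n
  step-arg< {suc n} _ (s≤s k≤n∸r) = s≤s (ℕP.≤-trans k≤n∸r (ℕP.m∸n≤m n r-1))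

  step-cong : ∀ {n} (s s' : ℕ → ℚ) → (∀ k → k < n → s k ≡ s' k) → L ≤ n → step s n ≡ step s' n
  step-cong {n} s s' s≡s' L≤n = cong (x *_) $ sumℚ-cong (suc (n ∸ r)) λ k k≤n∸r →
    cong (ℕ→ℚ ((n ∸ r) C k) *_) (s≡s' k (step-arg< L≤n k≤n∸r))

  fuelled-enough : ∀ f f' {n} → n < f → n < f' → fuelled f n ≡ fuelled f' n
  fuelled-enough (suc f) (suc f') {n} (s≤s n≤f) (s≤s n≤f') with n ℕP.<? L
  ... | yes n<L = trans (fuelled-init f n<L) (sym (fuelled-init f' n<L))
  ... | no  n≮L = trans (fuelled-step f L≤n) $ trans
        (step-cong (fuelled f) (fuelled f') (λ k k<n → fuelled-enough f f' (k<f k<n n≤f) (k<f k<n n≤f')) L≤n)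
        (sym (fuelled-step f' L≤n))
    where
    L≤n = ℕP.≮⇒≥ n≮L
    k<f : ∀ {k f} → k < n → n ≤ f → k < f
    k<f = ℕP.<-≤-trans

  recSeq-init : ∀ {n} → n < L → recSeq L r init x n ≡ init n
  recSeq-init {n} = fuelled-init n

  recSeq-step : ∀ {n} → L ≤ n → recSeq L r init x n ≡ step (recSeq L r init x) n
  recSeq-step {n} L≤n = trans (fuelled-step n L≤n)
    (step-cong (fuelled n) (recSeq L r init x) (λ k k<n → fuelled-enough n (suc k) k<n ℕP.≤-refl) L≤n)

  recSeq-+ : ∀ m → L ≤ m ℕ.+ r →
             recSeq L r init x (m ℕ.+ r) ≡ x * sumℚ (suc m) (λ k → ℕ→ℚ (m C k) * recSeq L r init x k)
  recSeq-+ m L≤m+r = trans (recSeq-step L≤m+r)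
    (cong (λ t → x * sumℚ (suc t) (λ k → ℕ→ℚ (t C k) * recSeq L r init x k)) (ℕP.m+n∸n≡m m r))

-- Shifting the summation index in D

inv-fact-pow-inverse : ∀ k r → inv-fact-pow k r * ℕ→ℚ (k !) ^ℚ r ≡ 1ℚ
inv-fact-pow-inverse k r = trans (cong (inv-fact-pow k r *_) (sym (ℕ→ℚ-homo-^ (k !) r)))
                                 (1/n*n≡1 ((k !) ℕ.^ r) {{m^n≢0 (k !) r {{k !≢0}}}})

inv-fact-pow-suc : ∀ m r → inv-fact-pow (suc m) r * ℕ→ℚ (suc m) ^ℚ r ≡ inv-fact-pow m r
inv-fact-pow-suc m r = begin
  u * S                                    ≡⟨ ℚP.*-identityʳ (u * S) ⟨
  u * S * 1ℚ                               ≡⟨ cong (u * S *_) (inv-fact-pow-inverse m r) ⟨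
  u * S * (v * F)                          ≡⟨ solve 4 (λ u S v F → u :* S :* (v :* F) := u :* (S :* F) :* v)
                                                      refl u S v F ⟩
  u * (S * F) * v                          ≡⟨ cong (λ w → u * w * v) (^ℚ-distrib-* (ℕ→ℚ (suc m)) (ℕ→ℚ (m !)) r) ⟨
  u * (ℕ→ℚ (suc m) * ℕ→ℚ (m !)) ^ℚ r * v   ≡⟨ cong (λ w → u * w ^ℚ r * v) (ℕ→ℚ-homo-* (suc m) (m !)) ⟨
  u * ℕ→ℚ (suc m !) ^ℚ r * v               ≡⟨ cong (_* v) (inv-fact-pow-inverse (suc m) r) ⟩
  1ℚ * v                                   ≡⟨ ℚP.*-identityˡ v ⟩
  v                                        ∎
  where
  open ≡-Reasoning
  open ℚSolver.+-*-Solver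
  u = inv-fact-pow (suc m) r
  v = inv-fact-pow m r
  S = ℕ→ℚ (suc m) ^ℚ r
  F = ℕ→ℚ (m !) ^ℚ r

module DShift (r-1 : ℕ) (x : ℚ) where

  open ℚSolver.+-*-Solver

  r : ℕ
  r = suc r-1

  term : ℕ → ℕ → ℚ
  term n k = ℕ→ℚ (k ℕ.^ n) * x ^ℚ k * inv-fact-pow k r

  shifted : ℕ → ℕ → ℚ
  shifted n m = ℕ→ℚ (suc m ℕ.^ n) * x ^ℚ m * inv-fact-pow m r

  term-0 : ∀ n → term (n ℕ.+ r) 0 ≡ 0ℚ
  term-0 n = begin
    ℕ→ℚ (0 ℕ.^ (n ℕ.+ r)) * 1ℚ * inv-fact-pow 0 r
      ≡⟨ cong (λ t → ℕ→ℚ (0 ℕ.^ t) * 1ℚ * inv-fact-pow 0 r) (ℕP.+-suc n r-1) ⟩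
    0ℚ * 1ℚ * inv-fact-pow 0 r
      ≡⟨ ℚP.*-zeroˡ (inv-fact-pow 0 r) ⟩
    0ℚ ∎
    where open ≡-Reasoning

  term-suc : ∀ n m → term (n ℕ.+ r) (suc m) ≡ x * shifted n m
  term-suc n m = begin
    ℕ→ℚ (suc m ℕ.^ (n ℕ.+ r)) * (x * X) * u
      ≡⟨ cong (λ w → w * (x * X) * u) power-split ⟩
    A * S * (x * X) * u
      ≡⟨ solve 5 (λ A S x X u → A :* S :* (x :* X) :* u := x :* (A :* X :* (u :* S))) refl A S x X u ⟩
    x * (A * X * (u * S))
      ≡⟨ cong (λ w → x * (A * X * w)) (inv-fact-pow-suc m r) ⟩
    x * shifted n m ∎
    where
    open ≡-Reasoning
    A = ℕ→ℚ (suc m ℕ.^ n)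
    S = ℕ→ℚ (suc m) ^ℚ r
    X = x ^ℚ m
    u = inv-fact-pow (suc m) r
    power-split : ℕ→ℚ (suc m ℕ.^ (n ℕ.+ r)) ≡ A * S
    power-split = trans (cong ℕ→ℚ (ℕP.^-distribˡ-+-* (suc m) n r))
                        (trans (ℕ→ℚ-homo-* (suc m ℕ.^ n) (suc m ℕ.^ r)) (cong (A *_) (ℕ→ℚ-homo-^ (suc m) r)))

  shifted-expand : ∀ n m → shifted n m ≡ sumℚ (suc n) (λ k → ℕ→ℚ (n C k) * term k m)
  shifted-expand n m = begin
    ℕ→ℚ (suc m ℕ.^ n) * X * u                                 ≡⟨ ℚP.*-assoc (ℕ→ℚ (suc m ℕ.^ n)) X u ⟩
    ℕ→ℚ (suc m ℕ.^ n) * (X * u)                               ≡⟨ cong (_* (X * u)) binomial-ℕ ⟩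
    sumℚ (suc n) (λ k → ℕ→ℚ (n C k) * ℕ→ℚ m ^ℚ k) * (X * u)   ≡⟨ ℚP.*-comm _ (X * u) ⟩
    (X * u) * sumℚ (suc n) (λ k → ℕ→ℚ (n C k) * ℕ→ℚ m ^ℚ k)   ≡⟨ sumℚ-*ˡ (suc n) (X * u) _ ⟨
    sumℚ (suc n) (λ k → (X * u) * (ℕ→ℚ (n C k) * ℕ→ℚ m ^ℚ k)) ≡⟨ sumℚ-cong (suc n) (λ k _ → rearrange k) ⟩
    sumℚ (suc n) (λ k → ℕ→ℚ (n C k) * term k m)               ∎
    where
    open ≡-Reasoning
    X = x ^ℚ m
    u = inv-fact-pow m r
    binomial-ℕ : ℕ→ℚ (suc m ℕ.^ n) ≡ sumℚ (suc n) (λ k → ℕ→ℚ (n C k) * ℕ→ℚ m ^ℚ k)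
    binomial-ℕ = trans (ℕ→ℚ-homo-^ (suc m) n) (trans (cong (_^ℚ n) (ℕ→ℚ-suc m)) (binomial (ℕ→ℚ m) n))
    rearrange : ∀ k → (X * u) * (ℕ→ℚ (n C k) * ℕ→ℚ m ^ℚ k) ≡ ℕ→ℚ (n C k) * term k m
    rearrange k = trans (solve 4 (λ X u c M → X :* u :* (c :* M) := c :* (M :* X :* u)) refl
                                 X u (ℕ→ℚ (n C k)) (ℕ→ℚ m ^ℚ k))
                        (cong (λ v → ℕ→ℚ (n C k) * (v * X * u)) (sym (ℕ→ℚ-homo-^ m k)))

  sum-shifted : ∀ n N → sumℚ N (shifted n) ≡ sumℚ (suc n) (λ k → ℕ→ℚ (n C k) * D r k x N)
  sum-shifted n N = begin
    sumℚ N (shifted n)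
      ≡⟨ sumℚ-cong N (λ m _ → shifted-expand n m) ⟩
    sumℚ N (λ m → sumℚ (suc n) (λ k → ℕ→ℚ (n C k) * term k m))
      ≡⟨ sumℚ-swap N (suc n) _ ⟩
    sumℚ (suc n) (λ k → sumℚ N (λ m → ℕ→ℚ (n C k) * term k m))
      ≡⟨ sumℚ-cong (suc n) (λ k _ → sumℚ-*ˡ N (ℕ→ℚ (n C k)) (term k)) ⟩
    sumℚ (suc n) (λ k → ℕ→ℚ (n C k) * D r k x N) ∎
    where open ≡-Reasoning

  D-shift : ∀ n N →
    D r (n ℕ.+ r) x (suc N) ≡ x * (sumℚ (suc n) (λ k → ℕ→ℚ (n C k) * D r k x (suc N)) - shifted n N)
  D-shift n N = begin
    D r (n ℕ.+ r) x (suc N)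
      ≡⟨ sumℚ-head N (term (n ℕ.+ r)) ⟩
    term (n ℕ.+ r) 0 + sumℚ N (term (n ℕ.+ r) ∘ suc)
      ≡⟨ cong₂ _+_ (term-0 n) (trans (sumℚ-cong N (λ m _ → term-suc n m)) (sumℚ-*ˡ N x (shifted n))) ⟩
    0ℚ + x * sumℚ N (shifted n)
      ≡⟨ solve 3 (λ x s t → con 0ℚ :+ x :* s := x :* ((s :+ t) :- t)) refl x (sumℚ N (shifted n)) (shifted n N) ⟩
    x * (sumℚ (suc N) (shifted n) - shifted n N)
      ≡⟨ cong (λ v → x * (v - shifted n N)) (sum-shifted n (suc N)) ⟩
    x * (sumℚ (suc n) (λ k → ℕ→ℚ (n C k) * D r k x (suc N)) - shifted n N) ∎
    where open ≡-Reasoning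

-- Congruences modulo a prime inside ℚ

-- Arithmetic modulo p is done on rationals: y is Integral if y d ∈ ℤ for some d prime to p,
-- Divisible if moreover y d ∈ pℤ, and x ≡ₚ y means that x − y is Divisible. The module is
-- parametrised by p − 2 so that both p − 1 and p are successors.
module Modulo (p-2 : ℕ) (p-prime : Prime (suc (suc p-2))) where

  open ℚSolver.+-*-Solver

  p-1 p : ℕ
  p-1 = suc p-2
  p   = suc p-1

  p∤_ : ℤ → Set
  p∤ d = p ∤ ℤ.∣ d ∣

  p∤ℕ-* : ∀ m n → p ∤ m → p ∤ n → p ∤ m ℕ.* n
  p∤ℕ-* m n p∤m p∤n = [ p∤m , p∤n ] ∘ euclidsLemma m n p-prime

  p∤-* : ∀ d e → p∤ d → p∤ e → p∤ (d ℤ.* e)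
  p∤-* d e p∤d p∤e = p∤ℕ-* ℤ.∣ d ∣ ℤ.∣ e ∣ p∤d p∤e ∘ subst (p ∣_) (ℤP.abs-* d e)

  p∤1 : p∤ (ℤ.+ 1)
  p∤1 p∣1 with ∣1⇒≡1 p∣1
  ... | ()

  p∤-<p : ∀ {k} → suc k < p → p∤ (ℤ.+ suc k)
  p∤-<p = >⇒∤

  p∤^ : ∀ m n → p ∤ m → p ∤ m ℕ.^ n
  p∤^ m zero    _   = p∤1
  p∤^ m (suc n) p∤m = p∤ℕ-* m (m ℕ.^ n) p∤m (p∤^ m n p∤m)

  p∤! : ∀ {k} → k < p → p ∤ k !
  p∤! {zero}  _   = p∤1
  p∤! {suc k} k<p = p∤ℕ-* (suc k) (k !) (p∤-<p k<p) (p∤! (ℕP.<-trans (ℕP.n<1+n k) k<p))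

  record Integral (y : ℚ) : Set where
    constructor integral
    field
      denominator   : ℤ
      p∤denominator : p∤ denominator
      numerator     : ℤ
      clears        : y * ℤ→ℚ denominator ≡ ℤ→ℚ numerator

  record Divisible (y : ℚ) : Set where
    constructor divisible
    field
      denominator   : ℤ
      p∤denominator : p∤ denominator
      cofactor      : ℤ
      clears        : y * ℤ→ℚ denominator ≡ ℕ→ℚ p * ℤ→ℚ cofactor

  Integral-+ : ∀ {x y} → Integral x → Integral y → Integral (x + y)
  Integral-+ {x} {y} (integral d p∤d a xd≡a) (integral d' p∤d' a' yd'≡a') =
    integral (d ℤ.* d') (p∤-* d d' p∤d p∤d') (a ℤ.* d' ℤ.+ a' ℤ.* d) $ begin
      (x + y) * ℤ→ℚ (d ℤ.* d')                  ≡⟨ clear-+ x y d d' ⟩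
      x * ℤ→ℚ d * ℤ→ℚ d' + y * ℤ→ℚ d' * ℤ→ℚ d   ≡⟨ cong₂ (λ u v → u * ℤ→ℚ d' + v * ℤ→ℚ d) xd≡a yd'≡a' ⟩
      ℤ→ℚ a * ℤ→ℚ d' + ℤ→ℚ a' * ℤ→ℚ d          ≡⟨ cong₂ _+_ (ℤ→ℚ-homo-* a d') (ℤ→ℚ-homo-* a' d) ⟨
      ℤ→ℚ (a ℤ.* d') + ℤ→ℚ (a' ℤ.* d)          ≡⟨ ℤ→ℚ-homo-+ (a ℤ.* d') (a' ℤ.* d) ⟨
      ℤ→ℚ (a ℤ.* d' ℤ.+ a' ℤ.* d)              ∎
    where open ≡-Reasoning

  Integral-* : ∀ {x y} → Integral x → Integral y → Integral (x * y)
  Integral-* {x} {y} (integral d p∤d a xd≡a) (integral d' p∤d' a' yd'≡a') =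
    integral (d ℤ.* d') (p∤-* d d' p∤d p∤d') (a ℤ.* a')
      (trans (clear-* x y d d') (trans (cong₂ _*_ xd≡a yd'≡a') (sym (ℤ→ℚ-homo-* a a'))))

  Integral-ℤ→ℚ : ∀ a → Integral (ℤ→ℚ a)
  Integral-ℤ→ℚ a = integral (ℤ.+ 1) p∤1 a (ℚP.*-identityʳ (ℤ→ℚ a))

  Integral-ℕ→ℚ : ∀ n → Integral (ℕ→ℚ n)
  Integral-ℕ→ℚ n = Integral-ℤ→ℚ (ℤ.+ n)

  Integral-^ : ∀ {x} n → Integral x → Integral (x ^ℚ n)
  Integral-^ zero    _  = Integral-ℕ→ℚ 1
  Integral-^ (suc n) ix = Integral-* ix (Integral-^ n ix)

  Integral-[-1]^ : ∀ k → Integral ([-1]^ k)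
  Integral-[-1]^ k = Integral-^ k (Integral-ℤ→ℚ -[1+ 0 ])

  Integral-sum : ∀ N {f : ℕ → ℚ} → (∀ k → k < N → Integral (f k)) → Integral (sumℚ N f)
  Integral-sum zero    _  = Integral-ℕ→ℚ 0
  Integral-sum (suc N) if = Integral-+ (Integral-sum N (λ k k<N → if k (ℕP.m<n⇒m<1+n k<N))) (if N ℕP.≤-refl)

  Integral-δ : ∀ i j → Integral (δ i j)
  Integral-δ i j with i ℕ.≡ᵇ j
  ... | true  = Integral-ℕ→ℚ 1
  ... | false = Integral-ℕ→ℚ 0

  Integral-inv-fact-pow : ∀ {k} r → k < p → Integral (inv-fact-pow k r)
  Integral-inv-fact-pow {k} r k<p = integral (ℤ.+ ((k !) ℕ.^ r)) (p∤^ (k !) r (p∤! k<p)) (ℤ.+ 1)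
    (1/n*n≡1 ((k !) ℕ.^ r) {{m^n≢0 (k !) r {{k !≢0}}}})

  Divisible-+ : ∀ {x y} → Divisible x → Divisible y → Divisible (x + y)
  Divisible-+ {x} {y} (divisible d p∤d a xd≡pa) (divisible d' p∤d' a' yd'≡pa') =
    divisible (d ℤ.* d') (p∤-* d d' p∤d p∤d') (a ℤ.* d' ℤ.+ a' ℤ.* d) $ begin
      (x + y) * ℤ→ℚ (d ℤ.* d')                    ≡⟨ clear-+ x y d d' ⟩
      x * ℤ→ℚ d * ℤ→ℚ d' + y * ℤ→ℚ d' * ℤ→ℚ d     ≡⟨ cong₂ (λ u v → u * ℤ→ℚ d' + v * ℤ→ℚ d) xd≡pa yd'≡pa' ⟩
      P * ℤ→ℚ a * ℤ→ℚ d' + P * ℤ→ℚ a' * ℤ→ℚ d     ≡⟨ solve 5 (λ P A D' A' D → P :* A :* D' :+ P :* A' :* D :=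
                                                                                P :* (A :* D' :+ A' :* D))
                                                             refl P (ℤ→ℚ a) (ℤ→ℚ d') (ℤ→ℚ a') (ℤ→ℚ d) ⟩
      P * (ℤ→ℚ a * ℤ→ℚ d' + ℤ→ℚ a' * ℤ→ℚ d)       ≡⟨ cong (P *_) (cong₂ _+_ (ℤ→ℚ-homo-* a d') (ℤ→ℚ-homo-* a' d)) ⟨
      P * (ℤ→ℚ (a ℤ.* d') + ℤ→ℚ (a' ℤ.* d))       ≡⟨ cong (P *_) (ℤ→ℚ-homo-+ (a ℤ.* d') (a' ℤ.* d)) ⟨
      P * ℤ→ℚ (a ℤ.* d' ℤ.+ a' ℤ.* d)             ∎
    where
    open ≡-Reasoning
    P = ℕ→ℚ p

  Divisible-* : ∀ {x y} → Divisible x → Integral y → Divisible (x * y)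
  Divisible-* {x} {y} (divisible d p∤d a xd≡pa) (integral d' p∤d' a' yd'≡a') =
    divisible (d ℤ.* d') (p∤-* d d' p∤d p∤d') (a ℤ.* a') $ begin
      (x * y) * ℤ→ℚ (d ℤ.* d')     ≡⟨ clear-* x y d d' ⟩
      (x * ℤ→ℚ d) * (y * ℤ→ℚ d')   ≡⟨ cong₂ _*_ xd≡pa yd'≡a' ⟩
      ℕ→ℚ p * ℤ→ℚ a * ℤ→ℚ a'       ≡⟨ ℚP.*-assoc (ℕ→ℚ p) (ℤ→ℚ a) (ℤ→ℚ a') ⟩
      ℕ→ℚ p * (ℤ→ℚ a * ℤ→ℚ a')     ≡⟨ cong (ℕ→ℚ p *_) (ℤ→ℚ-homo-* a a') ⟨
      ℕ→ℚ p * ℤ→ℚ (a ℤ.* a')       ∎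
    where open ≡-Reasoning

  Divisible-neg : ∀ {x} → Divisible x → Divisible (- x)
  Divisible-neg {x} (divisible d p∤d a xd≡pa) = divisible d p∤d (ℤ.- a) $ begin
    - x * ℤ→ℚ d             ≡⟨ ℚP.neg-distribˡ-* x (ℤ→ℚ d) ⟨
    - (x * ℤ→ℚ d)           ≡⟨ cong -_ xd≡pa ⟩
    - (ℕ→ℚ p * ℤ→ℚ a)       ≡⟨ ℚP.neg-distribʳ-* (ℕ→ℚ p) (ℤ→ℚ a) ⟩
    ℕ→ℚ p * - ℤ→ℚ a         ≡⟨ cong (ℕ→ℚ p *_) (ℤ→ℚ-homo‿- a) ⟨
    ℕ→ℚ p * ℤ→ℚ (ℤ.- a)     ∎
    where open ≡-Reasoning

  Divisible-p : Divisible (ℕ→ℚ p)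
  Divisible-p = divisible (ℤ.+ 1) p∤1 (ℤ.+ 1) refl

  Divisible-0 : Divisible 0ℚ
  Divisible-0 = divisible (ℤ.+ 1) p∤1 (ℤ.+ 0) (trans (ℚP.*-zeroˡ 1ℚ) (sym (ℚP.*-zeroʳ (ℕ→ℚ p))))

  Divisible-sum : ∀ N {f : ℕ → ℚ} → (∀ k → k < N → Divisible (f k)) → Divisible (sumℚ N f)
  Divisible-sum zero    _  = Divisible-0
  Divisible-sum (suc N) df = Divisible-+ (Divisible-sum N (λ k k<N → df k (ℕP.m<n⇒m<1+n k<N))) (df N ℕP.≤-refl)

  Divisible-cancelʳ : ∀ {x} a → p∤ a → Divisible (x * ℤ→ℚ a) → Divisible x
  Divisible-cancelʳ {x} a p∤a (divisible d p∤d c xad≡pc) =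
    divisible (a ℤ.* d) (p∤-* a d p∤a p∤d) c
      (trans (cong (x *_) (ℤ→ℚ-homo-* a d)) (trans (sym (ℚP.*-assoc x (ℤ→ℚ a) (ℤ→ℚ d))) xad≡pc))

  Divisible-ℤ→ℚ⇒p∣ : ∀ i → Divisible (ℤ→ℚ i) → p ∣ ℤ.∣ i ∣
  Divisible-ℤ→ℚ⇒p∣ i (divisible d p∤d c id≡pc) =
    [ id , ⊥-elim ∘ p∤d ] (euclidsLemma ℤ.∣ i ∣ ℤ.∣ d ∣ p-prime (divides ℤ.∣ c ∣ ∣i∣∣d∣≡∣c∣p))
    where
    id≡pc-in-ℤ : i ℤ.* d ≡ ℤ.+ p ℤ.* c
    id≡pc-in-ℤ = ℤ→ℚ-injective (trans (ℤ→ℚ-homo-* i d) (trans id≡pc (sym (ℤ→ℚ-homo-* (ℤ.+ p) c))))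
    ∣i∣∣d∣≡∣c∣p : ℤ.∣ i ∣ ℕ.* ℤ.∣ d ∣ ≡ ℤ.∣ c ∣ ℕ.* p
    ∣i∣∣d∣≡∣c∣p = trans (sym (ℤP.abs-* i d))
      (trans (cong ℤ.∣_∣ id≡pc-in-ℤ) (trans (ℤP.abs-* (ℤ.+ p) c) (ℕP.*-comm p ℤ.∣ c ∣)))

  Integral⇒p∤↧ : ∀ {y} → Integral y → p ∤ ℚ.denominatorℕ y
  Integral⇒p∤↧ {y} (integral d p∤d a yd≡a) p∣↧ = p∤d (∣-trans p∣↧ ↧∣d)
    where
    N = ℚ.numerator y
    M = ℚ.denominatorℕ y
    Nd≡aM : N ℤ.* d ≡ a ℤ.* ℤ.+ M
    Nd≡aM = ℤ→ℚ-injective $ begin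
      ℤ→ℚ (N ℤ.* d)        ≡⟨ ℤ→ℚ-homo-* N d ⟩
      ℤ→ℚ N * ℤ→ℚ d        ≡⟨ cong (_* ℤ→ℚ d) (*-↧≡↥ y) ⟨
      y * ℕ→ℚ M * ℤ→ℚ d    ≡⟨ solve 3 (λ y M d → y :* M :* d := y :* d :* M) refl y (ℕ→ℚ M) (ℤ→ℚ d) ⟩
      y * ℤ→ℚ d * ℕ→ℚ M    ≡⟨ cong (_* ℕ→ℚ M) yd≡a ⟩
      ℤ→ℚ a * ℕ→ℚ M        ≡⟨ ℤ→ℚ-homo-* a (ℤ.+ M) ⟨
      ℤ→ℚ (a ℤ.* ℤ.+ M)    ∎
      where open ≡-Reasoning
    ↧∣d : M ∣ ℤ.∣ d ∣
    ↧∣d = coprime-divisor (coprime-sym (↥-↧-coprime y)) $ divides ℤ.∣ a ∣ $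
      trans (sym (ℤP.abs-* N d)) (trans (cong ℤ.∣_∣ Nd≡aM) (ℤP.abs-* a (ℤ.+ M)))

  infix 4 _≡ₚ_
  record _≡ₚ_ (x y : ℚ) : Set where
    constructor ≡ₚ-intro
    field
      divisible-difference : Divisible (x - y)

  resp-≡ : ∀ {x y} → x ≡ y → Divisible y → Divisible x
  resp-≡ refl dy = dy

  Divisible⇒≡ₚ0 : ∀ {x} → Divisible x → x ≡ₚ 0ℚ
  Divisible⇒≡ₚ0 {x} dx = ≡ₚ-intro (resp-≡ (ℚP.+-identityʳ x) dx)

  ≡⇒≡ₚ : ∀ {x y} → x ≡ y → x ≡ₚ y
  ≡⇒≡ₚ {x} refl = ≡ₚ-intro (resp-≡ (ℚP.+-inverseʳ x) Divisible-0)

  ≡ₚ-refl : ∀ {x} → x ≡ₚ x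
  ≡ₚ-refl = ≡⇒≡ₚ refl

  ≡ₚ-sym : ∀ {x y} → x ≡ₚ y → y ≡ₚ x
  ≡ₚ-sym {x} {y} (≡ₚ-intro d) =
    ≡ₚ-intro (resp-≡ (solve 2 (λ x y → y :- x := :- (x :- y)) refl x y) (Divisible-neg d))

  ≡ₚ-trans : ∀ {x y z} → x ≡ₚ y → y ≡ₚ z → x ≡ₚ z
  ≡ₚ-trans {x} {y} {z} (≡ₚ-intro d) (≡ₚ-intro d') =
    ≡ₚ-intro (resp-≡ (solve 3 (λ x y z → x :- z := (x :- y) :+ (y :- z)) refl x y z) (Divisible-+ d d'))

  ≡ₚ-setoid : Setoid _ _
  ≡ₚ-setoid = record
    { Carrier       = ℚ
    ; _≈_           = _≡ₚ_
    ; isEquivalence = record { refl = ≡ₚ-refl ; sym = ≡ₚ-sym ; trans = ≡ₚ-trans }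
    }

  module ≡ₚ-Reasoning = SetoidReasoning ≡ₚ-setoid

  ≡ₚ-+ : ∀ {x x' y y'} → x ≡ₚ x' → y ≡ₚ y' → x + y ≡ₚ x' + y'
  ≡ₚ-+ {x} {x'} {y} {y'} (≡ₚ-intro d) (≡ₚ-intro d') = ≡ₚ-intro $
    resp-≡ (solve 4 (λ x x' y y' → (x :+ y) :- (x' :+ y') := (x :- x') :+ (y :- y')) refl x x' y y')
           (Divisible-+ d d')

  ≡ₚ-neg : ∀ {x y} → x ≡ₚ y → - x ≡ₚ - y
  ≡ₚ-neg {x} {y} (≡ₚ-intro d) = ≡ₚ-intro $
    resp-≡ (solve 2 (λ x y → (:- x) :- (:- y) := :- (x :- y)) refl x y) (Divisible-neg d)

  ≡ₚ-*ˡ : ∀ {c x y} → Integral c → x ≡ₚ y → c * x ≡ₚ c * y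
  ≡ₚ-*ˡ {c} {x} {y} ic (≡ₚ-intro d) = ≡ₚ-intro $
    resp-≡ (solve 3 (λ c x y → c :* x :- c :* y := (x :- y) :* c) refl c x y) (Divisible-* d ic)

  ≡ₚ-* : ∀ {x x' y y'} → Integral x' → Integral y → x ≡ₚ x' → y ≡ₚ y' → x * y ≡ₚ x' * y'
  ≡ₚ-* {x} {x'} {y} {y'} ix' iy (≡ₚ-intro d) (≡ₚ-intro d') = ≡ₚ-intro $
    resp-≡ (solve 4 (λ x x' y y' → (x :* y) :- (x' :* y') := (x :- x') :* y :+ (y :- y') :* x') refl x x' y y')
           (Divisible-+ (Divisible-* d iy) (Divisible-* d' ix'))

  ≡ₚ-^ : ∀ {x y} n → Integral x → Integral y → x ≡ₚ y → x ^ℚ n ≡ₚ y ^ℚ n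
  ≡ₚ-^ zero    ix iy x≡y = ≡ₚ-refl
  ≡ₚ-^ (suc n) ix iy x≡y = ≡ₚ-* iy (Integral-^ n ix) x≡y (≡ₚ-^ n ix iy x≡y)

  sumℚ-cong-≡ₚ : ∀ N {f g : ℕ → ℚ} → (∀ k → k < N → f k ≡ₚ g k) → sumℚ N f ≡ₚ sumℚ N g
  sumℚ-cong-≡ₚ zero    _   = ≡ₚ-refl
  sumℚ-cong-≡ₚ (suc N) f≡g = ≡ₚ-+ (sumℚ-cong-≡ₚ N (λ k k<N → f≡g k (ℕP.m<n⇒m<1+n k<N))) (f≡g N ℕP.≤-refl)

  ℤ→ℚ≡ₚ%ℕ : ∀ a → ℤ→ℚ a ≡ₚ ℕ→ℚ (a %ℕ p)
  ℤ→ℚ≡ₚ%ℕ a = ≡ₚ-intro (resp-≡ difference (Divisible-* Divisible-p (Integral-ℤ→ℚ q)))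
    where
    q = a /ℕ p
    r = a %ℕ p
    difference : ℤ→ℚ a - ℕ→ℚ r ≡ ℕ→ℚ p * ℤ→ℚ q
    difference = begin
      ℤ→ℚ a - ℕ→ℚ r                          ≡⟨ cong (λ v → ℤ→ℚ v - ℕ→ℚ r) (a≡a%ℕn+[a/ℕn]*n a p) ⟩
      ℤ→ℚ (ℤ.+ r ℤ.+ q ℤ.* ℤ.+ p) - ℕ→ℚ r    ≡⟨ cong (_- ℕ→ℚ r) (trans (ℤ→ℚ-homo-+ (ℤ.+ r) (q ℤ.* ℤ.+ p))
                                                                      (cong (ℕ→ℚ r +_) (ℤ→ℚ-homo-* q (ℤ.+ p)))) ⟩
      (ℕ→ℚ r + ℤ→ℚ q * ℕ→ℚ p) - ℕ→ℚ r        ≡⟨ solve 3 (λ r q p → (r :+ q :* p) :- r := p :* q) refl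
                                                         (ℕ→ℚ r) (ℤ→ℚ q) (ℕ→ℚ p) ⟩
      ℕ→ℚ p * ℤ→ℚ q                          ∎
      where open ≡-Reasoning

  ℕ→ℚ[%p]≡ₚ : ∀ u → ℕ→ℚ (u % p) ≡ₚ ℕ→ℚ u
  ℕ→ℚ[%p]≡ₚ u = ≡ₚ-sym (ℤ→ℚ≡ₚ%ℕ (ℤ.+ u))

  ≡ₚ⇒%≡ : ∀ u v → ℕ→ℚ u ≡ₚ ℕ→ℚ v → u % p ≡ v % p
  ≡ₚ⇒%≡ u v (≡ₚ-intro u-v) = ∣∣m⊖n∣⇒%≡ u v $ subst (p ∣_) (cong ℤ.∣_∣ (ℤP.[+m]-[+n]≡m⊖n u v)) $
    Divisible-ℤ→ℚ⇒p∣ (ℤ.+ u ℤ.- ℤ.+ v) (resp-≡ ℤ→ℚ[u-v] u-v)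
    where
    ℤ→ℚ[u-v] : ℤ→ℚ (ℤ.+ u ℤ.- ℤ.+ v) ≡ ℕ→ℚ u - ℕ→ℚ v
    ℤ→ℚ[u-v] = trans (ℤ→ℚ-homo-+ (ℤ.+ u) (ℤ.- ℤ.+ v)) (cong (λ w → ℕ→ℚ u + w) (ℤ→ℚ-homo‿- (ℤ.+ v)))

  -- Fermat and Wilson

  Divisible-pC[k+1] : ∀ k → suc k < p → Divisible (ℕ→ℚ (p C suc k))
  Divisible-pC[k+1] k k+1<p = divisible (ℤ.+ suc k) (p∤-<p k+1<p) (ℤ.+ (p-1 C k)) $ begin
    ℕ→ℚ (p C suc k) * ℕ→ℚ (suc k)  ≡⟨ ℕ→ℚ-homo-* (p C suc k) (suc k) ⟨
    ℕ→ℚ ((p C suc k) ℕ.* suc k)    ≡⟨ cong ℕ→ℚ (trans (ℕP.*-comm (p C suc k) (suc k))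
                                                      ([k+1]*[n+1]C[k+1]≡[n+1]*nCk p-1 k)) ⟩
    ℕ→ℚ (p ℕ.* (p-1 C k))          ≡⟨ ℕ→ℚ-homo-* p (p-1 C k) ⟩
    ℕ→ℚ p * ℕ→ℚ (p-1 C k)          ∎
    where open ≡-Reasoning

  fermat-ℕ : ∀ a → ℕ→ℚ a ^ℚ p ≡ₚ ℕ→ℚ a
  fermat-ℕ zero    = ≡⇒≡ₚ (ℚP.*-zeroˡ (ℕ→ℚ 0 ^ℚ p-1))
  fermat-ℕ (suc a) = begin
    ℕ→ℚ (suc a) ^ℚ p                   ≡⟨ cong (_^ℚ p) (ℕ→ℚ-suc a) ⟩
    (A + 1ℚ) ^ℚ p                      ≡⟨ binomial A p ⟩
    sumℚ p t + t p                     ≡⟨ cong (_+ t p) (sumℚ-head p-1 t) ⟩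
    (t 0 + sumℚ p-1 (t ∘ suc)) + t p   ≈⟨ ≡ₚ-+ (≡ₚ-+ (≡ₚ-refl {t 0}) (Divisible⇒≡ₚ0 (Divisible-sum p-1 middle)))
                                              (≡ₚ-refl {t p}) ⟩
    (t 0 + 0ℚ) + t p                   ≡⟨ cong (λ c → (t 0 + 0ℚ) + ℕ→ℚ c * A ^ℚ p) (nCn≡1 p) ⟩
    (1ℚ * 1ℚ + 0ℚ) + 1ℚ * A ^ℚ p       ≡⟨ solve 1 (λ z → (con 1ℚ :* con 1ℚ :+ con 0ℚ) :+ con 1ℚ :* z := z :+ con 1ℚ)
                                                  refl (A ^ℚ p) ⟩
    A ^ℚ p + 1ℚ                        ≈⟨ ≡ₚ-+ (fermat-ℕ a) (≡ₚ-refl {1ℚ}) ⟩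
    A + 1ℚ                             ≡⟨ ℕ→ℚ-suc a ⟨
    ℕ→ℚ (suc a)                        ∎
    where
    open ≡ₚ-Reasoning
    A = ℕ→ℚ a
    t = λ k → ℕ→ℚ (p C k) * A ^ℚ k
    middle : ∀ k → k < p-1 → Divisible (t (suc k))
    middle k k<p-1 = Divisible-* (Divisible-pC[k+1] k (s≤s k<p-1)) (Integral-^ (suc k) (Integral-ℕ→ℚ a))

  fermat-ℤ : ∀ a → ℤ→ℚ a ^ℚ p ≡ₚ ℤ→ℚ a
  fermat-ℤ a = begin
    ℤ→ℚ a ^ℚ p          ≈⟨ ≡ₚ-^ p (Integral-ℤ→ℚ a) (Integral-ℕ→ℚ (a %ℕ p)) (ℤ→ℚ≡ₚ%ℕ a) ⟩
    ℕ→ℚ (a %ℕ p) ^ℚ p   ≈⟨ fermat-ℕ (a %ℕ p) ⟩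
    ℕ→ℚ (a %ℕ p)        ≈⟨ ℤ→ℚ≡ₚ%ℕ a ⟨
    ℤ→ℚ a               ∎
    where open ≡ₚ-Reasoning

  fermat-ℤ-unit : ∀ a → p∤ a → ℤ→ℚ a ^ℚ p-1 ≡ₚ 1ℚ
  fermat-ℤ-unit a p∤a = ≡ₚ-intro $ Divisible-cancelʳ a p∤a $
    resp-≡ (solve 2 (λ X A → (X :- con 1ℚ) :* A := A :* X :- A) refl (ℤ→ℚ a ^ℚ p-1) (ℤ→ℚ a))
           (_≡ₚ_.divisible-difference (fermat-ℤ a))

  fermat : ∀ x d a → p∤ d → p∤ a → x * ℤ→ℚ d ≡ ℤ→ℚ a → x ^ℚ p-1 ≡ₚ 1ℚ
  fermat x d a p∤d p∤a xd≡a = begin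
    x ^ℚ p-1                  ≡⟨ ℚP.*-identityʳ (x ^ℚ p-1) ⟨
    x ^ℚ p-1 * 1ℚ             ≈⟨ ≡ₚ-*ˡ (Integral-^ p-1 (Integral x ∋ integral d p∤d a xd≡a)) (fermat-ℤ-unit d p∤d) ⟨
    x ^ℚ p-1 * ℤ→ℚ d ^ℚ p-1   ≡⟨ ^ℚ-distrib-* x (ℤ→ℚ d) p-1 ⟨
    (x * ℤ→ℚ d) ^ℚ p-1        ≡⟨ cong (_^ℚ p-1) xd≡a ⟩
    ℤ→ℚ a ^ℚ p-1              ≈⟨ fermat-ℤ-unit a p∤a ⟩
    1ℚ                        ∎
    where open ≡ₚ-Reasoning

  altPowerSum[p-1]≡ₚ : altPowerSum p-1 p-1 ≡ₚ altPowerSum 0 p-1 - 1ℚ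
  altPowerSum[p-1]≡ₚ = begin
    altPowerSum p-1 p-1                      ≡⟨ sumℚ-head p-1 (t p-1) ⟩
    t p-1 0 + sumℚ p-1 (t p-1 ∘ suc)         ≈⟨ ≡ₚ-+ (≡⇒≡ₚ t[p-1,0]≡0) (sumℚ-cong-≡ₚ p-1 k^[p-1]≡ₚ1) ⟩
    0ℚ + S                                   ≡⟨ solve 1 (λ s → con 0ℚ :+ s := (con 1ℚ :+ s) :- con 1ℚ) refl S ⟩
    (t 0 0 + S) - 1ℚ                         ≡⟨ cong (_- 1ℚ) (sumℚ-head p-1 (t 0)) ⟨
    altPowerSum 0 p-1 - 1ℚ                   ∎
    where
    open ≡ₚ-Reasoning
    t : ℕ → ℕ → ℚ
    t m k = ℕ→ℚ (p-1 C k) * ([-1]^ k * ℕ→ℚ k ^ℚ m)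
    S = sumℚ p-1 (t 0 ∘ suc)
    t[p-1,0]≡0 : t p-1 0 ≡ 0ℚ
    t[p-1,0]≡0 = cong (λ z → 1ℚ * (1ℚ * z)) (ℚP.*-zeroˡ (ℕ→ℚ 0 ^ℚ p-2))
    k^[p-1]≡ₚ1 : ∀ k → k < p-1 → t p-1 (suc k) ≡ₚ t 0 (suc k)
    k^[p-1]≡ₚ1 k k<p-1 = ≡ₚ-*ˡ (Integral-ℕ→ℚ (p-1 C suc k)) $ ≡ₚ-*ˡ (Integral-[-1]^ (suc k)) $
      fermat-ℤ-unit (ℤ.+ suc k) (p∤-<p (s≤s k<p-1))

  wilson : ℕ→ℚ (p-1 !) ≡ₚ - 1ℚ
  wilson = begin
    ℕ→ℚ (p-1 !)                ≡⟨ ℚP.*-identityˡ (ℕ→ℚ (p-1 !)) ⟨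
    1ℚ * ℕ→ℚ (p-1 !)           ≈⟨ ≡ₚ-* (Integral-ℕ→ℚ 1) (Integral-ℕ→ℚ (p-1 !)) (fermat-ℤ-unit -[1+ 0 ] p∤1) ≡ₚ-refl ⟨
    [-1]^ p-1 * ℕ→ℚ (p-1 !)    ≡⟨ altPowerSum-diag p-1 ⟨
    altPowerSum p-1 p-1        ≈⟨ altPowerSum[p-1]≡ₚ ⟩
    altPowerSum 0 p-1 - 1ℚ     ≡⟨ cong (_- 1ℚ) (altPowerSum-below {0} {p-1} (s≤s z≤n)) ⟩
    - 1ℚ                       ∎
    where open ≡ₚ-Reasoning

  inv-fact-pow[p-1]≡ₚ : ∀ r → inv-fact-pow p-1 r ≡ₚ [-1]^ r
  inv-fact-pow[p-1]≡ₚ r = begin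
    u                          ≡⟨ ℚP.*-identityʳ u ⟨
    u * 1ℚ                     ≡⟨ cong (u *_) ([-1]^k*[-1]^k≡1 r) ⟨
    u * ([-1]^ r * [-1]^ r)    ≈⟨ ≡ₚ-*ˡ (Integral-inv-fact-pow r ℕP.≤-refl)
                                        (≡ₚ-* (Integral-[-1]^ r) (Integral-[-1]^ r) W≡ₚ[-1]^r ≡ₚ-refl) ⟨
    u * (W * [-1]^ r)          ≡⟨ ℚP.*-assoc u W ([-1]^ r) ⟨
    u * W * [-1]^ r            ≡⟨ cong (_* [-1]^ r) (inv-fact-pow-inverse p-1 r) ⟩
    1ℚ * [-1]^ r               ≡⟨ ℚP.*-identityˡ ([-1]^ r) ⟩
    [-1]^ r                    ∎
    where
    open ≡ₚ-Reasoning
    u = inv-fact-pow p-1 r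
    W = ℕ→ℚ (p-1 !) ^ℚ r
    W≡ₚ[-1]^r : W ≡ₚ [-1]^ r
    W≡ₚ[-1]^r = ≡ₚ-^ r (Integral-ℕ→ℚ (p-1 !)) (Integral-ℤ→ℚ -[1+ 0 ]) wilson

  -- redℚ p y is (↥ y mod p) · (↧ y)^(p−2), and (↧ y)^(p−2) inverts ↧ y modulo p by Fermat.
  redℚ≡ₚ : ∀ {y} → Integral y → ℕ→ℚ (redℚ p y) ≡ₚ y
  redℚ≡ₚ {y} iy = begin
    ℕ→ℚ (R % p)                   ≈⟨ ℕ→ℚ[%p]≡ₚ R ⟩
    ℕ→ℚ R                         ≡⟨ trans (ℕ→ℚ-homo-* (N %ℕ p) (M ℕ.^ p-2))
                                           (cong (ℕ→ℚ (N %ℕ p) *_) (ℕ→ℚ-homo-^ M p-2)) ⟩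
    ℕ→ℚ (N %ℕ p) * ℕ→ℚ M ^ℚ p-2   ≈⟨ ≡ₚ-* (Integral-ℕ→ℚ (N %ℕ p)) (Integral-^ p-2 (Integral-ℕ→ℚ M))
                                         (ℤ→ℚ≡ₚ%ℕ N) (≡ₚ-refl {ℕ→ℚ M ^ℚ p-2}) ⟨
    ℤ→ℚ N * ℕ→ℚ M ^ℚ p-2          ≡⟨ cong (_* ℕ→ℚ M ^ℚ p-2) (*-↧≡↥ y) ⟨
    y * ℕ→ℚ M * ℕ→ℚ M ^ℚ p-2      ≡⟨ ℚP.*-assoc y (ℕ→ℚ M) (ℕ→ℚ M ^ℚ p-2) ⟩
    y * ℕ→ℚ M ^ℚ p-1              ≈⟨ ≡ₚ-*ˡ iy (fermat-ℤ-unit (ℤ.+ M) (Integral⇒p∤↧ iy)) ⟩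
    y * 1ℚ                        ≡⟨ ℚP.*-identityʳ y ⟩
    y                             ∎
    where
    open ≡ₚ-Reasoning
    N = ℚ.numerator y
    M = ℚ.denominatorℕ y
    R = (N %ℕ p) ℕ.* M ℕ.^ p-2

  infix 4 _represents_
  record _represents_ (a : 𝒜) (y : ℚ) : Set where
    constructor represents-intro
    field
      residue≡ₚ : ℕ→ℚ (a p) ≡ₚ y

  ι-represents : ∀ {y} → Integral y → ι y represents y
  ι-represents iy = represents-intro (redℚ≡ₚ iy)

  +𝒜-represents : ∀ {a c y z} → a represents y → c represents z → (a +𝒜 c) represents (y + z)
  +𝒜-represents {a} {c} {y} {z} (represents-intro a~y) (represents-intro c~z) = represents-intro $ begin
    ℕ→ℚ ((a p ℕ.+ c p) % p)   ≈⟨ ℕ→ℚ[%p]≡ₚ (a p ℕ.+ c p) ⟩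
    ℕ→ℚ (a p ℕ.+ c p)         ≡⟨ ℕ→ℚ-homo-+ (a p) (c p) ⟩
    ℕ→ℚ (a p) + ℕ→ℚ (c p)     ≈⟨ ≡ₚ-+ a~y c~z ⟩
    y + z                     ∎
    where open ≡ₚ-Reasoning

  ·𝒜-represents : ∀ {q a y} → Integral q → a represents y → (q ·𝒜 a) represents (q * y)
  ·𝒜-represents {q} {a} {y} iq (represents-intro a~y) = represents-intro $ begin
    ℕ→ℚ ((redℚ p q ℕ.* a p) % p)   ≈⟨ ℕ→ℚ[%p]≡ₚ (redℚ p q ℕ.* a p) ⟩
    ℕ→ℚ (redℚ p q ℕ.* a p)         ≡⟨ ℕ→ℚ-homo-* (redℚ p q) (a p) ⟩
    ℕ→ℚ (redℚ p q) * ℕ→ℚ (a p)     ≈⟨ ≡ₚ-* iq (Integral-ℕ→ℚ (a p)) (redℚ≡ₚ iq) a~y ⟩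
    q * y                          ∎
    where open ≡ₚ-Reasoning

  sum𝒜-represents : ∀ N {f : ℕ → 𝒜} {y : ℕ → ℚ} →
                    (∀ j → j < N → f j represents y j) → sum𝒜 N f represents sumℚ N y
  sum𝒜-represents zero    _   = represents-intro ≡ₚ-refl
  sum𝒜-represents (suc N) f~y =
    +𝒜-represents (sum𝒜-represents N (λ j j<N → f~y j (ℕP.m<n⇒m<1+n j<N))) (f~y N ℕP.≤-refl)

  represents-≡ₚ : ∀ {a c y z} → a represents y → c represents z → y ≡ₚ z → modP p (a p) ≡ modP p (c p)
  represents-≡ₚ {a} {c} (represents-intro a~y) (represents-intro c~z) y≡z =
    ≡ₚ⇒%≡ (a p) (c p) (≡ₚ-trans a~y (≡ₚ-trans y≡z (≡ₚ-sym c~z)))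

  module _ (x : ℚ) (x≢0 : x ≢ 0ℚ) (height<p : ℤ.∣ ℚ.numerator x ∣ ℕ.+ ℚ.denominatorℕ x < p) where

    private
      ↥x : ℤ
      ↥x = ℚ.numerator x

      ↧x : ℕ
      ↧x = ℚ.denominatorℕ x

      p∤↧x : p∤ (ℤ.+ ↧x)
      p∤↧x = >⇒∤ (ℕP.≤-<-trans (ℕP.m≤n+m ↧x ℤ.∣ ↥x ∣) height<p)

      p∤↥x : p∤ ↥x
      p∤↥x = >⇒∤ {{ℕ.≢-nonZero (x≢0 ∘ ℚP.↥p≡0⇒p≡0 x ∘ ℤP.∣i∣≡0⇒i≡0)}}
                 (ℕP.≤-<-trans (ℕP.m≤m+n ℤ.∣ ↥x ∣ ↧x) height<p)

    Integral-small-height : Integral x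
    Integral-small-height = integral (ℤ.+ ↧x) p∤↧x ↥x (*-↧≡↥ x)

    fermat-small-height : x ^ℚ p-1 ≡ₚ 1ℚ
    fermat-small-height = fermat x (ℤ.+ ↧x) ↥x p∤↧x p∤↥x (*-↧≡↥ x)

  -- The recurrence modulo p

  module Recurrence (r-1 : ℕ) (x : ℚ) (ix : Integral x) where

    r : ℕ
    r = suc r-1

    c : ℚ
    c = [-1]^ r-1 * x

    module B (j : ℕ) = RecSeq r-1 r-1 (δ j) x
    module G = RecSeq r r-1 (λ n → c * δ n r) x

    b-below : ∀ j {n} → n < r → b r j x n ≡ δ j n
    b-below j = B.recSeq-init j

    b-step : ∀ j m → b r j x (m ℕ.+ r) ≡ x * sumℚ (suc m) (λ k → ℕ→ℚ (m C k) * b r j x k)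
    b-step j m = B.recSeq-+ j m (ℕP.m≤n+m r m)

    g-below : ∀ {n} → n < r → g r x n ≡ 0ℚ
    g-below {n} n<r = trans (G.recSeq-init (ℕP.m<n⇒m<1+n n<r))
                            (trans (cong (c *_) (δ-≢ (ℕP.<⇒≢ n<r))) (ℚP.*-zeroʳ c))

    g-step : ∀ m → g r x (m ℕ.+ r) ≡ x * sumℚ (suc m) (λ k → ℕ→ℚ (m C k) * g r x k) + c * δ m 0
    g-step zero    = begin
      g r x r                              ≡⟨ G.recSeq-init (ℕP.n<1+n r) ⟩
      c * δ r r                            ≡⟨ cong (c *_) (δ-refl r) ⟩
      c * 1ℚ                               ≡⟨ solve 2 (λ x c → c :* con 1ℚ :=
                                                           x :* (con 0ℚ :+ con 1ℚ :* (c :* con 0ℚ)) :+ c :* con 1ℚ)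
                                                      refl x c ⟩
      x * (0ℚ + 1ℚ * (c * 0ℚ)) + c * 1ℚ    ≡⟨ cong (λ v → x * (0ℚ + 1ℚ * v) + c * 1ℚ) (G.recSeq-init (s≤s z≤n)) ⟨
      x * (0ℚ + 1ℚ * g r x 0) + c * 1ℚ     ∎
      where open ≡-Reasoning
    g-step (suc m) = trans (G.recSeq-+ (suc m) (s≤s (ℕP.m≤n+m r m)))
                           (sym (trans (cong (X +_) (ℚP.*-zeroʳ c)) (ℚP.+-identityʳ X)))
      where X = x * sumℚ (suc (suc m)) (λ k → ℕ→ℚ (suc m C k) * g r x k)

    Integral-recSeq : ∀ L-1 (init : ℕ → ℚ) → (∀ n → Integral (init n)) →
                      ∀ n → Integral (recSeq (suc L-1) r init x n)
    Integral-recSeq L-1 init i-init = <-rec (λ n → Integral (recSeq L r init x n)) go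
      where
      open RecSeq L-1 r-1 init x using (L; recSeq-init; recSeq-step; step-arg<)
      go : ∀ n → (∀ {k} → k < n → Integral (recSeq L r init x k)) → Integral (recSeq L r init x n)
      go n IH = by-cases (n ℕP.<? L)
        where
        by-cases : Dec (n < L) → Integral (recSeq L r init x n)
        by-cases (yes n<L) = subst Integral (sym (recSeq-init n<L)) (i-init n)
        by-cases (no  n≮L) = subst Integral (sym (recSeq-step L≤n)) $ Integral-* ix $
          Integral-sum (suc (n ∸ r)) λ k k≤n∸r →
            Integral-* (Integral-ℕ→ℚ ((n ∸ r) C k)) (IH (step-arg< L≤n k≤n∸r))
          where L≤n = ℕP.≮⇒≥ n≮L

    Integral-b : ∀ j n → Integral (b r j x n)
    Integral-b j = Integral-recSeq r-1 (δ j) (Integral-δ j)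

    Integral-g : ∀ n → Integral (g r x n)
    Integral-g = Integral-recSeq r (λ n → c * δ n r)
      (λ n → Integral-* (Integral-* (Integral-[-1]^ r-1) ix) (Integral-δ n r))

    module Solution (E : ℕ → ℚ)
                    (E-step : ∀ m → E (m ℕ.+ r) ≡ₚ x * sumℚ (suc m) (λ k → ℕ→ℚ (m C k) * E k) + c * δ m 0)
                    where

      Solves : ℕ → Set
      Solves n = E n ≡ₚ sumℚ r (λ j → b r j x n * E j) + g r x n

      solves-below : ∀ {n} → n < r → Solves n
      solves-below {n} n<r = ≡⇒≡ₚ $ sym $ trans
        (cong₂ _+_ (trans (sumℚ-cong r (λ j _ → cong (_* E j) (b-below j n<r))) (sumℚ-δ r E n<r))
                   (g-below n<r))
        (ℚP.+-identityʳ (E n))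

      solves-step : ∀ m → (∀ {k} → k < m ℕ.+ r → Solves k) → Solves (m ℕ.+ r)
      solves-step m IH = begin
        E (m ℕ.+ r)
          ≈⟨ E-step m ⟩
        x * sumℚ (suc m) (λ k → w k * E k) + cδ
          ≈⟨ ≡ₚ-+ (≡ₚ-*ˡ ix (sumℚ-cong-≡ₚ (suc m) λ k k≤m → ≡ₚ-*ˡ (Integral-ℕ→ℚ (m C k)) (IH (k<m+r k≤m))))
                  (≡ₚ-refl {cδ}) ⟩
        x * sumℚ (suc m) (λ k → w k * (sumℚ r (λ j → b r j x k * E j) + g r x k)) + cδ
          ≡⟨ cong (_+ cδ) (sumℚ-regroup (suc m) r x w (λ j → b r j x) E (g r x)) ⟩
        (sumℚ r (λ j → β j * E j) + x * sumℚ (suc m) (λ k → w k * g r x k)) + cδ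
          ≡⟨ ℚP.+-assoc (sumℚ r (λ j → β j * E j)) (x * sumℚ (suc m) (λ k → w k * g r x k)) cδ ⟩
        sumℚ r (λ j → β j * E j) + (x * sumℚ (suc m) (λ k → w k * g r x k) + cδ)
          ≡⟨ cong₂ _+_ (sumℚ-cong r (λ j _ → cong (_* E j) (b-step j m))) (g-step m) ⟨
        sumℚ r (λ j → b r j x (m ℕ.+ r) * E j) + g r x (m ℕ.+ r) ∎
        where
        open ≡ₚ-Reasoning
        w = λ k → ℕ→ℚ (m C k)
        β = λ j → x * sumℚ (suc m) (λ k → w k * b r j x k)
        cδ = c * δ m 0
        k<m+r : ∀ {k} → k < suc m → k < m ℕ.+ r
        k<m+r (s≤s k≤m) = ℕP.≤-<-trans k≤m (ℕP.m<m+n m (s≤s z≤n))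

      solves : ∀ n → Solves n
      solves = <-rec Solves go
        where
        go : ∀ n → (∀ {k} → k < n → Solves k) → Solves n
        go n IH = by-cases (n ℕP.<? r)
          where
          by-cases : Dec (n < r) → Solves n
          by-cases (yes n<r) = solves-below n<r
          by-cases (no  n≮r) = subst Solves n∸r+r≡n (solves-step (n ∸ r) (IH ∘ subst (_ <_) n∸r+r≡n))
            where n∸r+r≡n = ℕP.m∸n+n≡m (ℕP.≮⇒≥ n≮r)

    Integral-D : ∀ n → Integral (D r n x p)
    Integral-D n = Integral-sum p λ k k<p →
      Integral-* (Integral-* (Integral-ℕ→ℚ (k ℕ.^ n)) (Integral-^ k ix)) (Integral-inv-fact-pow r k<p)

    D𝒜-represents : ∀ n → D𝒜 r n x represents D r n x p
    D𝒜-represents n = represents-intro (redℚ≡ₚ (Integral-D n))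

    module _ (x^[p-1]≡ₚ1 : x ^ℚ p-1 ≡ₚ 1ℚ) where

      open DShift r-1 x using (shifted; D-shift)

      shifted≡ₚ : ∀ m → shifted m p-1 ≡ₚ [-1]^ r * δ m 0
      shifted≡ₚ zero    = begin
        ℕ→ℚ 1 * x ^ℚ p-1 * inv-fact-pow p-1 r
          ≈⟨ ≡ₚ-* (Integral-ℕ→ℚ 1) (Integral-inv-fact-pow r ℕP.≤-refl)
                  (≡ₚ-*ˡ (Integral-ℕ→ℚ 1) x^[p-1]≡ₚ1) (inv-fact-pow[p-1]≡ₚ r) ⟩
        1ℚ * 1ℚ * [-1]^ r
          ≡⟨ solve 1 (λ s → con 1ℚ :* con 1ℚ :* s := s :* con 1ℚ) refl ([-1]^ r) ⟩
        [-1]^ r * 1ℚ ∎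
        where open ≡ₚ-Reasoning
      shifted≡ₚ (suc m) = begin
        ℕ→ℚ (p ℕ.^ suc m) * x ^ℚ p-1 * inv-fact-pow p-1 r
          ≈⟨ Divisible⇒≡ₚ0 $ Divisible-* (Divisible-* p^[m+1] (Integral-^ p-1 ix))
                                         (Integral-inv-fact-pow r ℕP.≤-refl) ⟩
        0ℚ
          ≡⟨ ℚP.*-zeroʳ ([-1]^ r) ⟨
        [-1]^ r * 0ℚ ∎
        where
        open ≡ₚ-Reasoning
        p^[m+1] : Divisible (ℕ→ℚ (p ℕ.^ suc m))
        p^[m+1] = resp-≡ (ℕ→ℚ-homo-* p (p ℕ.^ m)) (Divisible-* Divisible-p (Integral-ℕ→ℚ (p ℕ.^ m)))

      D-step : ∀ m → D r (m ℕ.+ r) x p ≡ₚ x * sumℚ (suc m) (λ k → ℕ→ℚ (m C k) * D r k x p) + c * δ m 0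
      D-step m = begin
        D r (m ℕ.+ r) x p             ≡⟨ D-shift m p-1 ⟩
        x * (S - shifted m p-1)       ≈⟨ ≡ₚ-*ˡ ix (≡ₚ-+ (≡ₚ-refl {S}) (≡ₚ-neg (shifted≡ₚ m))) ⟩
        x * (S - [-1]^ r * δ m 0)     ≡⟨ solve 4 (λ x S s d → x :* (S :- (con (- 1ℚ) :* s) :* d) :=
                                                              x :* S :+ s :* x :* d)
                                                 refl x S ([-1]^ r-1) (δ m 0) ⟩
        x * S + c * δ m 0             ∎
        where
        open ≡ₚ-Reasoning
        S = sumℚ (suc m) (λ k → ℕ→ℚ (m C k) * D r k x p)

      open Solution (λ n → D r n x p) D-step

      D𝒜-identity : ∀ n → modP p (D𝒜 r n x p) ≡
                          modP p ((sum𝒜 r (λ j → b r j x n ·𝒜 D𝒜 r j x) +𝒜 ι (g r x n)) p)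
      D𝒜-identity n = represents-≡ₚ (D𝒜-represents n)
        (+𝒜-represents (sum𝒜-represents r (λ j _ → ·𝒜-represents (Integral-b j n) (D𝒜-represents j)))
                       (ι-represents (Integral-g n)))
        (solves n)

theorem2p10 : (r : ℕ) → 1 ≤ r → (x : ℚ) → x ≢ 0ℚ → (n : ℕ) →
    D𝒜 r n x ≈𝒜 (sum𝒜 r (λ j → b r j x n ·𝒜 D𝒜 r j x) +𝒜 ι (g r x n))
theorem2p10 (suc r-1) _ x x≢0 n = ℤ.∣ ℚ.numerator x ∣ ℕ.+ ℚ.denominatorℕ x , λ where
  (suc (suc p-2)) p-prime height<p →
    let open Modulo p-2 p-prime
    in  Recurrence.D𝒜-identity r-1 x (Integral-small-height x x≢0 height<p)
                                     (fermat-small-height x x≢0 height<p) n
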